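{- Let $n\geq 3$ be an integer and let $\mathscr{C}$ be the set of $3$-colorings $\alpha\colon\mathbb{Z}_{2n+1}\to\{1,2,3\}$ of $\vec{C}_{2n+1}\langle n\rangle$ whose three color classes are $\{a\}$, $\{a+1,a+2,\dots,a+n\}$ and $\{a+n+1,a+n+2,\dots,a+2n\}$ for some $a\in\mathbb{Z}_{2n+1}$. If $\alpha,\beta\in\mathscr{C}$, then $\alpha$ and $\beta$ are at distance at most $3n-1$ in $\mathcal{D}_3(\vec{C}_{2n+1}\langle n\rangle)$. Moreover, if the singleton color classes of $\alpha$ and $\beta$ have different colors, then $\alpha$ and $\beta$ are at distance at most $2n+1$.
   Context: For $n\ge2$, $\vec{C}_{2n+1}\langle n\rangle$ is the tournament with vertex set $\mathbb{Z}_{2n+1}$ and arcs $(a,a+j)$ for all $a\in\mathbb{Z}_{2n+1}$, $j\in\{1,\dots,n-1\}$, together with arcs $(a,a-n)$ for all $a\in\mathbb{Z}_{2n+1}$. A $k$-coloring of a digraph $D$ is a function $\alpha\colon V(D)\to\{1,\dots,k\}$ such that every color class $\{x:\alpha(x)=i\}$ (possibly empty) induces an acyclic subdigraph. The $k$-dicoloring graph $\mathcal{D}_k(D)$ has the $k$-colorings of $D$ as vertices, two being adjacent iff they differ on exactly one vertex. -}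

module Defs where

open import Data.Nat using (ℕ; zero; suc; _+_; _*_; _∸_; _≤_; _<_)
open import Data.Nat.DivMod using (_mod_)
open import Data.Fin using (Fin; toℕ)
open import Data.Product using (Σ; _×_; ∃; ∃-syntax)
open import Relation.Binary.PropositionalEquality using (_≡_; _≢_)
open import Relation.Nullary using (¬_)
open import Function.Definitions using (Injective)

N : ℕ → ℕ
N n = suc (n + n)

V : ℕ → Set
V n = Fin (N n)

shift : (n : ℕ) → V n → ℕ → V n
shift n x j = (toℕ x + j) mod (N n)

-- arcs of C⃗_{2n+1}⟨n⟩ : (a, a+j) for 1 ≤ j ≤ n-1, and (a, a-n) = (a, a+(n+1))
data Arc (n : ℕ) (x y : V n) : Set where
  fwd  : (j : ℕ) → 1 ≤ j → j ≤ n ∸ 1 → y ≡ (shift n x j) → Arc n x y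
  back : y ≡ (shift n x (n + 1)) → Arc n x y

record DCycle (n : ℕ) : Set where
  field
    len   : ℕ
    vert  : Fin (suc len) → V n
    inj   : Injective _≡_ _≡_ vert
    arcs  : (i : Fin (suc len)) → Arc n (vert i) (vert ((toℕ i + 1) mod (suc len)))

Col : ℕ → Set
Col n = V n → Fin 3

IsColoring : (n : ℕ) → Col n → Set
IsColoring n α = (c : Fin 3) → ¬ (Σ (DCycle n) λ C → (i : Fin (suc (DCycle.len C))) → α (DCycle.vert C i) ≡ c)

Adj : (n : ℕ) → Col n → Col n → Set
Adj n α β = ∃[ v ] (α v ≢ β v × ((w : V n) → w ≢ v → α w ≡ β w))

data Walk (n : ℕ) : Col n → Col n → ℕ → Set where
  done : {α β : Col n} → ((v : V n) → α v ≡ β v) → Walk n α β 0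
  step : {α γ β : Col n} {l : ℕ} → IsColoring n γ → Adj n α γ → Walk n γ β l → Walk n α β (suc l)

DistLe : (n : ℕ) → Col n → Col n → ℕ → Set
DistLe n α β k = ∃[ l ] (l ≤ k × Walk n α β l)

ShapeAt : (n : ℕ) → Col n → V n → Set
ShapeAt n α a =
  (α a ≢ α (shift n a 1)) × (α a ≢ α (shift n a (n + 1))) × (α (shift n a 1) ≢ α (shift n a (n + 1)))
  × ((j : ℕ) → 1 ≤ j → j ≤ n → α (shift n a j) ≡ α (shift n a 1))
  × ((j : ℕ) → n + 1 ≤ j → j ≤ n + n → α (shift n a j) ≡ α (shift n a (n + 1)))

InC : (n : ℕ) → Col n → Set
InC n α = IsColoring n α × ∃[ a ] ShapeAt n α a

{-# OPTIONS --safe #-}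

-- The colourings in 𝒞 are three-block colourings: ℤ_{2n+1} is cut into three runs of
-- consecutive vertices, of lengths 1, n and n, each run in one colour.  Every three-block
-- colouring whose runs have at most n vertices is a dicolouring, since inside a window of n
-- consecutive vertices every arc goes forward (arcs have length 1, …, n − 1 or n + 1), so the
-- position is a potential.  Moving the border between two runs by one vertex is a single
-- recolouring; such moves slide, grow and shrink the runs but never change the cyclic order
-- of the colours.  That order is changed by a hop: a singleton next to a run of length n jumps
-- to the far end of the run in two recolourings, and a pair of vertices jumps in four; the
-- intermediate colour classes are acyclic because no arc has length n or 2n.  Taking α's
-- singleton as origin and, after possibly exchanging α and β, β's singleton at e ≤ n steps
-- further, each of the six ways the colours of β can arrange those of α is reached by an
-- explicit sequence of these moves whose length is counted exactly.

module Submission where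

open import Defs
open import Data.Bool using (true; false; if_then_else_)
open import Data.Fin using (Fin; toℕ)
open import Data.Fin.Properties using (toℕ-fromℕ<; toℕ-injective; toℕ<n; all?) renaming (_≟_ to _≟ᶠ_)
open import Data.List using (_∷_; [])
open import Data.Nat using (ℕ; zero; suc; _+_; _*_; _∸_; _≤_; _<_; z≤n; s≤s; s≤s⁻¹; _<?_; _≟_; NonZero)
open import Data.Nat.DivMod using (_%_; _mod_; m%n<n; m<n⇒m%n≡m; [m+n]%n≡m%n; %-distribˡ-+; m%n%n≡m%n; n%n≡0)
open import Data.Nat.Properties
open import Data.Nat.Tactic.RingSolver using (solve)
open import Data.Product using (Σ; _×_; _,_; proj₁; proj₂; ∃-syntax)
open import Data.Sum using (_⊎_; inj₁; inj₂) renaming (map to ⊎-map)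
open import Data.Unit using (tt)
open import Relation.Binary.PropositionalEquality
open import Function using (_∘_; id; _∋_)
open import Relation.Nullary using (¬_; yes; no; does; contradiction)
open import Relation.Nullary.Decidable using (dec-true; dec-false; toWitness; _⊎-dec_)

%-absorbˡ : ∀ m k d .{{_ : NonZero d}} → (m % d + k) % d ≡ (m + k) % d
%-absorbˡ m k d = begin
  (m % d + k) % d          ≡⟨ %-distribˡ-+ (m % d) k d ⟩
  (m % d % d + k % d) % d  ≡⟨ cong (λ t → (t + k % d) % d) (m%n%n≡m%n m d) ⟩
  (m % d + k % d) % d      ≡⟨ %-distribˡ-+ m k d ⟨
  (m + k) % d              ∎
  where open ≡-Reasoning

%-absorbʳ : ∀ m k d .{{_ : NonZero d}} → (m + k % d) % d ≡ (m + k) % d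
%-absorbʳ m k d = begin
  (m + k % d) % d  ≡⟨ cong (_% d) (+-comm m (k % d)) ⟩
  (k % d + m) % d  ≡⟨ %-absorbˡ k m d ⟩
  (k + m) % d      ≡⟨ cong (_% d) (+-comm k m) ⟩
  (m + k) % d      ∎
  where open ≡-Reasoning

+-%-cases : ∀ {m j d} .{{_ : NonZero d}} → m < d → j ≤ d →
            m + j ≡ (m + j) % d ⊎ m + j ≡ (m + j) % d + d
+-%-cases {m} {j} {d} m<d j≤d with m + j <? d
... | yes m+j<d = inj₁ (sym (m<n⇒m%n≡m m+j<d))
... | no m+j≮d = inj₂ (begin
  m + j                     ≡⟨ m∸n+n≡m d≤m+j ⟨
  (m + j ∸ d) + d           ≡⟨ cong (_+ d) (m<n⇒m%n≡m m+j∸d<d) ⟨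
  (m + j ∸ d) % d + d       ≡⟨ cong (_+ d) ([m+n]%n≡m%n (m + j ∸ d) d) ⟨
  ((m + j ∸ d) + d) % d + d ≡⟨ cong (λ t → t % d + d) (m∸n+n≡m d≤m+j) ⟩
  (m + j) % d + d           ∎)
  where
  open ≡-Reasoning
  d≤m+j : d ≤ m + j
  d≤m+j = ≮⇒≥ m+j≮d
  m+j∸d<d : m + j ∸ d < d
  m+j∸d<d = +-cancelʳ-< _ _ d (subst (_< d + d) (sym (m∸n+n≡m d≤m+j)) (+-mono-<-≤ m<d j≤d))

≤-by : ∀ {a b} d → a + d ≡ b → a ≤ b
≤-by {a} d a+d≡b = subst (a ≤_) a+d≡b (m≤m+n a d)

∸-<-cancel : ∀ {p t m} → p ≤ t → t < p + m → t ∸ p < m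
∸-<-cancel {p} {t} {m} p≤t t<p+m = +-cancelˡ-< p (t ∸ p) m (subst (_< p + m) (sym (m+[n∸m]≡n p≤t)) t<p+m)

∸-≤-cancel : ∀ {p t m} → p ≤ t → p + m ≤ t → m ≤ t ∸ p
∸-≤-cancel {p} {t} {m} p≤t p+m≤t = +-cancelˡ-≤ p m (t ∸ p) (subst (p + m ≤_) (sym (m+[n∸m]≡n p≤t)) p+m≤t)

Distinct : Fin 3 → Fin 3 → Fin 3 → Set
Distinct x y z = x ≢ y × y ≢ z × x ≢ z

distinct-xzy : ∀ {x y z} → Distinct x y z → Distinct x z y
distinct-xzy (x≢y , y≢z , x≢z) = x≢z , ≢-sym y≢z , x≢y

distinct-yxz : ∀ {x y z} → Distinct x y z → Distinct y x z
distinct-yxz (x≢y , y≢z , x≢z) = ≢-sym x≢y , x≢z , y≢z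

distinct-yzx : ∀ {x y z} → Distinct x y z → Distinct y z x
distinct-yzx (x≢y , y≢z , x≢z) = y≢z , ≢-sym x≢z , ≢-sym x≢y

distinct-zxy : ∀ {x y z} → Distinct x y z → Distinct z x y
distinct-zxy (x≢y , y≢z , x≢z) = ≢-sym x≢z , x≢y , ≢-sym y≢z

distinct-zyx : ∀ {x y z} → Distinct x y z → Distinct z y x
distinct-zyx (x≢y , y≢z , x≢z) = ≢-sym y≢z , ≢-sym x≢y , ≢-sym x≢z

fin3-pigeonhole : ∀ (x y z w : Fin 3) → x ≡ y ⊎ y ≡ z ⊎ x ≡ z ⊎ w ≡ x ⊎ w ≡ y ⊎ w ≡ z
fin3-pigeonhole = toWitness {a? = all? λ x → all? λ y → all? λ z → all? λ w →
  x ≟ᶠ y ⊎-dec y ≟ᶠ z ⊎-dec x ≟ᶠ z ⊎-dec w ≟ᶠ x ⊎-dec w ≟ᶠ y ⊎-dec w ≟ᶠ z} tt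

fin3-cover : ∀ {x y z} → Distinct x y z → ∀ w → w ≡ x ⊎ w ≡ y ⊎ w ≡ z
fin3-cover {x} {y} {z} (x≢y , y≢z , x≢z) w with fin3-pigeonhole x y z w
... | inj₁ x≡y                 = contradiction x≡y x≢y
... | inj₂ (inj₁ y≡z)          = contradiction y≡z y≢z
... | inj₂ (inj₂ (inj₁ x≡z))   = contradiction x≡z x≢z
... | inj₂ (inj₂ (inj₂ among)) = among

data Arrangement (x y z : Fin 3) : Fin 3 → Fin 3 → Fin 3 → Set where
  xyz : Arrangement x y z x y z
  xzy : Arrangement x y z x z y
  yxz : Arrangement x y z y x z
  yzx : Arrangement x y z y z x
  zxy : Arrangement x y z z x y
  zyx : Arrangement x y z z y x

arrangement : ∀ {x y z d₀ d₁ d₂} → Distinct x y z → Distinct d₀ d₁ d₂ → Arrangement x y z d₀ d₁ d₂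
arrangement {d₀ = d₀} {d₁} {d₂} d (d₀≢d₁ , d₁≢d₂ , d₀≢d₂) with fin3-cover d d₀ | fin3-cover d d₁ | fin3-cover d d₂
... | inj₁ refl        | inj₂ (inj₁ refl) | inj₂ (inj₂ refl) = xyz
... | inj₁ refl        | inj₂ (inj₂ refl) | inj₂ (inj₁ refl) = xzy
... | inj₂ (inj₁ refl) | inj₁ refl        | inj₂ (inj₂ refl) = yxz
... | inj₂ (inj₁ refl) | inj₂ (inj₂ refl) | inj₁ refl        = yzx
... | inj₂ (inj₂ refl) | inj₁ refl        | inj₂ (inj₁ refl) = zxy
... | inj₂ (inj₂ refl) | inj₂ (inj₁ refl) | inj₁ refl        = zyx
... | inj₁ refl        | inj₁ refl        | _                = contradiction refl d₀≢d₁
... | inj₂ (inj₁ refl) | inj₂ (inj₁ refl) | _                = contradiction refl d₀≢d₁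
... | inj₂ (inj₂ refl) | inj₂ (inj₂ refl) | _                = contradiction refl d₀≢d₁
... | _                | inj₁ refl        | inj₁ refl        = contradiction refl d₁≢d₂
... | _                | inj₂ (inj₁ refl) | inj₂ (inj₁ refl) = contradiction refl d₁≢d₂
... | _                | inj₂ (inj₂ refl) | inj₂ (inj₂ refl) = contradiction refl d₁≢d₂
... | inj₁ refl        | _                | inj₁ refl        = contradiction refl d₀≢d₂
... | inj₂ (inj₁ refl) | _                | inj₂ (inj₁ refl) = contradiction refl d₀≢d₂
... | inj₂ (inj₂ refl) | _                | inj₂ (inj₂ refl) = contradiction refl d₀≢d₂

-- Three-block colourings are the case a = 0; a > 0 only occurs in the middle of a hop.
-- Opaque, so that unification can read the arguments of bands off its applications.
opaque
  bands : (a b c : ℕ) (x y z : Fin 3) → ℕ → Fin 3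
  bands a b c x y z o =
    if does (o <? a) then y else if does (o <? b) then x else if does (o <? c) then y else z

does-<?-suc : ∀ {o k} → o ≢ k → does (o <? k) ≡ does (o <? suc k)
does-<?-suc {o} {k} o≢k with o <? k
... | yes o<k = trans (dec-true (o <? k) o<k) (sym (dec-true (o <? suc k) (m<n⇒m<1+n o<k)))
... | no o≮k = trans (dec-false (o <? k) o≮k)
                     (sym (dec-false (o <? suc k) λ o<k+1 → o≮k (≤∧≢⇒< (s≤s⁻¹ o<k+1) o≢k)))

opaque
  unfolding bands

  bands-y₀ : ∀ {a b c x y z o} → o < a → bands a b c x y z o ≡ y
  bands-y₀ {a} {o = o} o<a rewrite dec-true (o <? a) o<a = refl

  bands-x : ∀ {a b c x y z o} → a ≤ o → o < b → bands a b c x y z o ≡ x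
  bands-x {a} {b} {o = o} a≤o o<b rewrite dec-false (o <? a) (≤⇒≯ a≤o) | dec-true (o <? b) o<b = refl

  bands-y₁ : ∀ {a b c x y z o} → a ≤ o → b ≤ o → o < c → bands a b c x y z o ≡ y
  bands-y₁ {a} {b} {c} {o = o} a≤o b≤o o<c
    rewrite dec-false (o <? a) (≤⇒≯ a≤o) | dec-false (o <? b) (≤⇒≯ b≤o) | dec-true (o <? c) o<c = refl

  bands-z : ∀ {a b c x y z o} → a ≤ o → b ≤ o → c ≤ o → bands a b c x y z o ≡ z
  bands-z {a} {b} {c} {o = o} a≤o b≤o c≤o
    rewrite dec-false (o <? a) (≤⇒≯ a≤o) | dec-false (o <? b) (≤⇒≯ b≤o) | dec-false (o <? c) (≤⇒≯ c≤o) = refl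

  bands-agree-a : ∀ {a b c x y z o} → o ≢ a → bands a b c x y z o ≡ bands (suc a) b c x y z o
  bands-agree-a {a} {b} {c} {x} {y} {z} {o} o≢a =
    cong (λ t → if t then y else if does (o <? b) then x else if does (o <? c) then y else z) (does-<?-suc o≢a)

  bands-agree-b : ∀ {a b c x y z o} → o ≢ b → bands a b c x y z o ≡ bands a (suc b) c x y z o
  bands-agree-b {a} {b} {c} {x} {y} {z} {o} o≢b =
    cong (λ t → if does (o <? a) then y else if t then x else if does (o <? c) then y else z) (does-<?-suc o≢b)

  bands-agree-c : ∀ {a b c x y z o} → o ≢ c → bands a b c x y z o ≡ bands a b (suc c) x y z o
  bands-agree-c {a} {b} {c} {x} {y} {z} {o} o≢c =
    cong (λ t → if does (o <? a) then y else if does (o <? b) then x else if t then y else z) (does-<?-suc o≢c)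

bands-inv : ∀ {a b c x y z o w} → bands a b c x y z o ≡ w →
            (o < a ⊎ b ≤ o × o < c) × y ≡ w ⊎ (a ≤ o × o < b) × x ≡ w ⊎ c ≤ o × z ≡ w
bands-inv {a} {b} {c} {o = o} eq with o <? a | o <? b | o <? c
... | yes o<a | _       | _       = inj₁ (inj₁ o<a , trans (sym (bands-y₀ o<a)) eq)
... | no o≮a | yes o<b  | _       = inj₂ (inj₁ ((≮⇒≥ o≮a , o<b) , trans (sym (bands-x (≮⇒≥ o≮a) o<b)) eq))
... | no o≮a | no o≮b   | yes o<c = inj₁ (inj₂ (≮⇒≥ o≮b , o<c) , trans (sym (bands-y₁ (≮⇒≥ o≮a) (≮⇒≥ o≮b) o<c)) eq)
... | no o≮a | no o≮b   | no o≮c  =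
  inj₂ (inj₂ (≮⇒≥ o≮c , trans (sym (bands-z (≮⇒≥ o≮a) (≮⇒≥ o≮b) (≮⇒≥ o≮c))) eq))

bands-merge : ∀ {a c x y z} o → bands a c c x y z o ≡ bands 0 a c y x z o
bands-merge {a} {c} o with o <? a | o <? c
... | yes o<a | _        = trans (bands-y₀ o<a) (sym (bands-x z≤n o<a))
... | no o≮a | yes o<c  = trans (bands-x (≮⇒≥ o≮a) o<c) (sym (bands-y₁ z≤n (≮⇒≥ o≮a) o<c))
... | no o≮a | no o≮c   = trans (bands-z (≮⇒≥ o≮a) (≮⇒≥ o≮c) (≮⇒≥ o≮c)) (sym (bands-z z≤n (≮⇒≥ o≮a) (≮⇒≥ o≮c)))

module _ (n : ℕ) where

  -- Offsets and arcs in ℤ_{2n+1}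

  -- offset s v is v − s, as a number in [0, 2n].
  offset : V n → V n → ℕ
  offset s v = (toℕ v + (N n ∸ toℕ s)) % N n

  offset<N : ∀ s v → offset s v < N n
  offset<N s v = m%n<n (toℕ v + (N n ∸ toℕ s)) (N n)

  toℕ-shift : ∀ s j → toℕ (shift n s j) ≡ (toℕ s + j) % N n
  toℕ-shift s j = toℕ-fromℕ< (m%n<n (toℕ s + j) (N n))

  private
    %-around : ∀ s m → (toℕ s + m + (N n ∸ toℕ s)) % N n ≡ m % N n
    %-around s m = begin
      (toℕ s + m + (N n ∸ toℕ s)) % N n   ≡⟨ cong (λ t → (t + (N n ∸ toℕ s)) % N n) (+-comm (toℕ s) m) ⟩
      (m + toℕ s + (N n ∸ toℕ s)) % N n   ≡⟨ cong (_% N n) (+-assoc m (toℕ s) _) ⟩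
      (m + (toℕ s + (N n ∸ toℕ s))) % N n ≡⟨ cong (λ t → (m + t) % N n) (m+[n∸m]≡n (<⇒≤ (toℕ<n s))) ⟩
      (m + N n) % N n                     ≡⟨ [m+n]%n≡m%n m (N n) ⟩
      m % N n                             ∎
      where open ≡-Reasoning

  shift-offset : ∀ s v → shift n s (offset s v) ≡ v
  shift-offset s v = toℕ-injective (begin
    toℕ (shift n s (offset s v))                  ≡⟨ toℕ-shift s (offset s v) ⟩
    (toℕ s + (toℕ v + (N n ∸ toℕ s)) % N n) % N n ≡⟨ %-absorbʳ (toℕ s) _ (N n) ⟩
    (toℕ s + (toℕ v + (N n ∸ toℕ s))) % N n       ≡⟨ cong (_% N n) (+-assoc (toℕ s) (toℕ v) _) ⟨
    (toℕ s + toℕ v + (N n ∸ toℕ s)) % N n         ≡⟨ %-around s (toℕ v) ⟩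
    toℕ v % N n                                   ≡⟨ m<n⇒m%n≡m (toℕ<n v) ⟩
    toℕ v                                         ∎)
    where open ≡-Reasoning

  offset-shift : ∀ s j → offset s (shift n s j) ≡ j % N n
  offset-shift s j = begin
    (toℕ (shift n s j) + (N n ∸ toℕ s)) % N n   ≡⟨ cong (λ t → (t + (N n ∸ toℕ s)) % N n) (toℕ-shift s j) ⟩
    ((toℕ s + j) % N n + (N n ∸ toℕ s)) % N n   ≡⟨ %-absorbˡ (toℕ s + j) _ (N n) ⟩
    (toℕ s + j + (N n ∸ toℕ s)) % N n           ≡⟨ %-around s j ⟩
    j % N n                                     ∎
    where open ≡-Reasoning

  shift-% : ∀ s {i j} → i % N n ≡ j % N n → shift n s i ≡ shift n s j
  shift-% s {i} {j} i≡j = toℕ-injective (begin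
    toℕ (shift n s i)          ≡⟨ toℕ-shift s i ⟩
    (toℕ s + i) % N n          ≡⟨ %-absorbʳ (toℕ s) i (N n) ⟨
    (toℕ s + i % N n) % N n    ≡⟨ cong (λ t → (toℕ s + t) % N n) i≡j ⟩
    (toℕ s + j % N n) % N n    ≡⟨ %-absorbʳ (toℕ s) j (N n) ⟩
    (toℕ s + j) % N n          ≡⟨ toℕ-shift s j ⟨
    toℕ (shift n s j)          ∎)
    where open ≡-Reasoning

  shift-+ : ∀ s i j → shift n (shift n s i) j ≡ shift n s (i + j)
  shift-+ s i j = toℕ-injective (begin
    toℕ (shift n (shift n s i) j)  ≡⟨ toℕ-shift (shift n s i) j ⟩
    (toℕ (shift n s i) + j) % N n  ≡⟨ cong (λ t → (t + j) % N n) (toℕ-shift s i) ⟩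
    ((toℕ s + i) % N n + j) % N n  ≡⟨ %-absorbˡ (toℕ s + i) j (N n) ⟩
    (toℕ s + i + j) % N n          ≡⟨ cong (_% N n) (+-assoc (toℕ s) i j) ⟩
    (toℕ s + (i + j)) % N n        ≡⟨ toℕ-shift s (i + j) ⟨
    toℕ (shift n s (i + j))        ∎)
    where open ≡-Reasoning

  shift-zero : ∀ s → shift n s 0 ≡ s
  shift-zero s = toℕ-injective (trans (toℕ-shift s 0)
    (trans (cong (_% N n) (+-identityʳ (toℕ s))) (m<n⇒m%n≡m (toℕ<n s))))

  offset-rebase : ∀ s {p k} v → p + k ≡ N n → offset (shift n s p) v ≡ (offset s v + k) % N n
  offset-rebase s {p} {k} v p+k≡N = begin
    offset (shift n s p) v                                ≡⟨ cong (offset (shift n s p)) v≡ ⟩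
    offset (shift n s p) (shift n (shift n s p) (t + k)) ≡⟨ offset-shift (shift n s p) (t + k) ⟩
    (t + k) % N n                                         ∎
    where
    open ≡-Reasoning
    t = offset s v
    around : p + (t + k) ≡ t + N n
    around = trans (sym (+-assoc p t k)) (trans (cong (_+ k) (+-comm p t)) (trans (+-assoc t p k) (cong (t +_) p+k≡N)))
    v≡ : v ≡ shift n (shift n s p) (t + k)
    v≡ = begin
      v                             ≡⟨ shift-offset s v ⟨
      shift n s t                   ≡⟨ shift-% s (sym (trans (cong (_% N n) around) ([m+n]%n≡m%n t (N n)))) ⟩
      shift n s (p + (t + k))       ≡⟨ shift-+ s p (t + k) ⟨
      shift n (shift n s p) (t + k) ∎

  rotated-offset : ∀ {p q r t} → p + q + r ≡ N n → p ≤ t → t < N n → (t + (q + r)) % N n ≡ t ∸ p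
  rotated-offset {p} {q} {r} {t} sum p≤t t<N = begin
    (t + (q + r)) % N n ≡⟨ cong (_% N n) around ⟩
    (t ∸ p + N n) % N n ≡⟨ [m+n]%n≡m%n (t ∸ p) (N n) ⟩
    (t ∸ p) % N n       ≡⟨ m<n⇒m%n≡m (≤-<-trans (m∸n≤m t p) t<N) ⟩
    t ∸ p               ∎
    where
    open ≡-Reasoning
    around : t + (q + r) ≡ t ∸ p + N n
    around = begin
      t + (q + r)           ≡⟨ cong (_+ (q + r)) (m+[n∸m]≡n p≤t) ⟨
      p + (t ∸ p) + (q + r) ≡⟨ cong (_+ (q + r)) (+-comm p (t ∸ p)) ⟩
      t ∸ p + p + (q + r)   ≡⟨ +-assoc (t ∸ p) p (q + r) ⟩
      t ∸ p + (p + (q + r)) ≡⟨ cong (t ∸ p +_) (trans (sym (+-assoc p q r)) sum) ⟩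
      t ∸ p + N n           ∎

  data ArcLength (j : ℕ) : Set where
    short : 1 ≤ j → j ≤ n ∸ 1 → ArcLength j
    long  : j ≡ n + 1 → ArcLength j

  OffsetArc : ℕ → ℕ → Set
  OffsetArc o₁ o₂ = ∃[ j ] ArcLength j × (o₁ + j ≡ o₂ ⊎ o₁ + j ≡ o₂ + N n)

  ArcLength⇒≤ : ∀ {j} → ArcLength j → j ≤ n + 1
  ArcLength⇒≤ (short _ j≤n-1) = ≤-trans j≤n-1 (≤-trans (m∸n≤m n 1) (m≤m+n n 1))
  ArcLength⇒≤ (long refl) = ≤-refl

  ArcLength⇒>0 : ∀ {j} → ArcLength j → 0 < j
  ArcLength⇒>0 (short 1≤j _) = 1≤j
  ArcLength⇒>0 (long refl) = subst (0 <_) (+-comm 1 n) (s≤s z≤n)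

  ¬ArcLength-0 : ¬ ArcLength 0
  ¬ArcLength-0 (long 0≡n+1) = contradiction (trans (+-comm 1 n) (sym 0≡n+1)) λ ()

  ¬ArcLength-n : ¬ ArcLength n
  ¬ArcLength-n (short 1≤n n≤n-1) = <-irrefl refl (≤-<-trans n≤n-1 (∸-monoʳ-< {o = 0} (s≤s z≤n) 1≤n))
  ¬ArcLength-n (long n≡n+1) = m+1+n≢m n (sym n≡n+1)

  ¬ArcLength-2n : 2 ≤ n → ¬ ArcLength (n + n)
  ¬ArcLength-2n 2≤n (short _ 2n≤n-1) =
    <-irrefl refl (≤-<-trans 2n≤n-1 (≤-<-trans (m∸n≤m n 1) (m<m+n n (≤-trans (s≤s z≤n) 2≤n))))
  ¬ArcLength-2n 2≤n (long 2n≡n+1) = <-irrefl (sym (+-cancelˡ-≡ n n 1 2n≡n+1)) 2≤n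

  arc-length : ∀ {x y} → Arc n x y → ∃[ j ] ArcLength j × y ≡ shift n x j
  arc-length (fwd j 1≤j j≤n-1 y≡) = j , short 1≤j j≤n-1 , y≡
  arc-length (back y≡) = n + 1 , long refl , y≡

  n<N : n < N n
  n<N = s≤s (m≤m+n n n)

  n+1≤N : n + 1 ≤ N n
  n+1≤N = subst (_≤ N n) (+-comm 1 n) (s≤s (m≤m+n n n))

  arc-offsets : ∀ s {x y} → Arc n x y → OffsetArc (offset s x) (offset s y)
  arc-offsets s {x} arc with arc-length arc
  ... | j , len , refl = j , len ,
    ⊎-map (λ e → trans e (sym offset-y)) (λ e → trans e (cong (_+ N n) (sym offset-y)))
          (+-%-cases {d = N n} (offset<N s x) (≤-trans (ArcLength⇒≤ len) n+1≤N))
    where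
    offset-y : offset s (shift n x j) ≡ (offset s x + j) % N n
    offset-y = begin
      offset s (shift n x j)                        ≡⟨ cong (λ t → offset s (shift n t j)) (shift-offset s x) ⟨
      offset s (shift n (shift n s (offset s x)) j) ≡⟨ cong (offset s) (shift-+ s (offset s x) j) ⟩
      offset s (shift n s (offset s x + j))         ≡⟨ offset-shift s (offset s x + j) ⟩
      (offset s x + j) % N n                        ∎
      where open ≡-Reasoning

  no-offset-arc : 1 ≤ n → ∀ {o₁ o₂} d → d < N n → ¬ ArcLength d →
                  o₁ + d ≡ o₂ ⊎ o₁ + d ≡ o₂ + N n → ¬ OffsetArc o₁ o₂
  no-offset-arc 1≤n {o₁} {o₂} d d<N ¬len gap (j , len , reach) = ¬len (subst ArcLength (same-length gap reach) len)
    where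
    too-long : ∀ {k m} → o₁ + k ≡ o₂ + N n → o₁ + m ≡ o₂ → N n ≤ k
    too-long {k} {m} e₁ e₂ = subst (N n ≤_) (+-cancelˡ-≡ o₁ (m + N n) k (begin
      o₁ + (m + N n) ≡⟨ +-assoc o₁ m (N n) ⟨
      o₁ + m + N n   ≡⟨ cong (_+ N n) e₂ ⟩
      o₂ + N n       ≡⟨ e₁ ⟨
      o₁ + k         ∎)) (m≤n+m (N n) m)
      where open ≡-Reasoning
    same-length : o₁ + d ≡ o₂ ⊎ o₁ + d ≡ o₂ + N n → o₁ + j ≡ o₂ ⊎ o₁ + j ≡ o₂ + N n → j ≡ d
    same-length (inj₁ e) (inj₁ e′) = +-cancelˡ-≡ o₁ j d (trans e′ (sym e))
    same-length (inj₂ e) (inj₂ e′) = +-cancelˡ-≡ o₁ j d (trans e′ (sym e))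
    same-length (inj₁ e) (inj₂ e′) =
      contradiction (≤-trans (too-long e′ e) (ArcLength⇒≤ len)) (<⇒≱ (s≤s (+-monoʳ-≤ n 1≤n)))
    same-length (inj₂ e) (inj₁ e′) = contradiction (too-long e e′) (<⇒≱ d<N)

  offset-arc-irrefl : 1 ≤ n → ∀ {o} → ¬ OffsetArc o o
  offset-arc-irrefl 1≤n {o} = no-offset-arc 1≤n 0 (s≤s z≤n) ¬ArcLength-0 (inj₁ (+-identityʳ o))

  no-arc-of-length-n : 1 ≤ n → ∀ {o₁ o₂} → o₁ + n ≡ o₂ ⊎ o₁ + n ≡ o₂ + N n → ¬ OffsetArc o₁ o₂
  no-arc-of-length-n 1≤n = no-offset-arc 1≤n n n<N ¬ArcLength-n

  no-arc-of-length-2n : 2 ≤ n → ∀ {o₁ o₂} → o₁ + (n + n) ≡ o₂ + N n → ¬ OffsetArc o₁ o₂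
  no-arc-of-length-2n 2≤n eq =
    no-offset-arc (≤-trans (s≤s z≤n) 2≤n) (n + n) (n<1+n (n + n)) (¬ArcLength-2n 2≤n) (inj₂ eq)

  -- Acyclic colour classes

  ClassAcyclic : Col n → Fin 3 → Set
  ClassAcyclic γ c = ¬ (Σ (DCycle n) λ C → ∀ i → γ (DCycle.vert C i) ≡ c)

  acyclic-by-potential : ∀ {γ c} (P : V n → ℕ) →
    (∀ {x y} → γ x ≡ c → γ y ≡ c → Arc n x y → P x < P y) → ClassAcyclic γ c
  acyclic-by-potential P increasing (C , coloured) =
    m+1+n≰m (P (around 0)) (subst (λ v → P (around 0) + suc len ≤ P v) closes (climb (suc len)))
    where
    open DCycle C
    around : ℕ → V n
    around k = vert (k mod suc len)
    next : ∀ k → (toℕ (k mod suc len) + 1) mod suc len ≡ suc k mod suc len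
    next k = toℕ-injective (begin
      toℕ ((toℕ (k mod suc len) + 1) mod suc len) ≡⟨ toℕ-fromℕ< _ ⟩
      (toℕ (k mod suc len) + 1) % suc len         ≡⟨ cong (λ t → (t + 1) % suc len) (toℕ-fromℕ< (m%n<n k (suc len))) ⟩
      (k % suc len + 1) % suc len                 ≡⟨ %-absorbˡ k 1 (suc len) ⟩
      (k + 1) % suc len                           ≡⟨ cong (_% suc len) (+-comm k 1) ⟩
      suc k % suc len                             ≡⟨ toℕ-fromℕ< _ ⟨
      toℕ (suc k mod suc len)                     ∎)
      where open ≡-Reasoning
    climb : ∀ k → P (around 0) + k ≤ P (around k)
    climb zero = ≤-reflexive (+-identityʳ _)
    climb (suc k) = begin
      P (around 0) + suc k  ≡⟨ +-suc (P (around 0)) k ⟩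
      suc (P (around 0) + k) ≤⟨ s≤s (climb k) ⟩
      suc (P (around k))     ≤⟨ increasing (coloured _) (coloured _) (arcs (k mod suc len)) ⟩
      P (vert ((toℕ (k mod suc len) + 1) mod suc len)) ≡⟨ cong (P ∘ vert) (next k) ⟩
      P (around (suc k))     ∎
      where open ≤-Reasoning
    closes : around (suc len) ≡ around 0
    closes = cong vert (toℕ-injective
      (trans (toℕ-fromℕ< _) (trans (n%n≡0 (suc len)) (sym (toℕ-fromℕ< (m%n<n 0 (suc len)))))))

  opaque
    place : V n → (ℕ → Fin 3) → Col n
    place s F v = F (offset s v)

    place-offset : ∀ {s F} v → place s F v ≡ F (offset s v)
    place-offset v = refl

  acyclic-by-offset-potential : ∀ {s F c} (P : ℕ → ℕ) →
    (∀ {o₁ o₂} → o₁ < N n → o₂ < N n → F o₁ ≡ c → F o₂ ≡ c → OffsetArc o₁ o₂ → P o₁ < P o₂) →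
    ClassAcyclic (place s F) c
  acyclic-by-offset-potential {s} P increasing = acyclic-by-potential (P ∘ offset s)
    λ {x} {y} c₁ c₂ arc → increasing (offset<N s x) (offset<N s y)
      (trans (sym (place-offset x)) c₁) (trans (sym (place-offset y)) c₂) (arc-offsets s arc)

  window-acyclic : ∀ {s F c} t → (∀ {o} → o < N n → F o ≡ c → t ≤ o × o < t + n) →
                   ClassAcyclic (place s F) c
  window-acyclic {F = F} {c} t inside = acyclic-by-offset-potential id increasing
    where
    increasing : ∀ {o₁ o₂} → o₁ < N n → o₂ < N n → F o₁ ≡ c → F o₂ ≡ c → OffsetArc o₁ o₂ → o₁ < o₂
    increasing {o₁} _ _ _ _ (j , len , inj₁ o₁+j≡o₂) =
      subst (o₁ <_) o₁+j≡o₂ (subst (_≤ o₁ + j) (+-comm o₁ 1) (+-monoʳ-≤ o₁ (ArcLength⇒>0 len)))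
    increasing {o₁} {o₂} l₁ l₂ c₁ c₂ (j , len , inj₂ o₁+j≡o₂+N) = contradiction (begin-strict
      o₂ + N n          ≡⟨ o₁+j≡o₂+N ⟨
      o₁ + j            <⟨ +-mono-<-≤ (proj₂ (inside l₁ c₁)) (ArcLength⇒≤ len) ⟩
      t + n + (n + 1)   ≡⟨ solve (t ∷ n ∷ []) ⟩
      t + (1 + (n + n)) ≤⟨ +-monoˡ-≤ (N n) (proj₁ (inside l₂ c₂)) ⟩
      o₂ + N n          ∎) (<-irrefl refl)
      where open ≤-Reasoning

  triple-acyclic : 1 ≤ n → ∀ {s F c} p q r →
    (∀ {o} → o < N n → F o ≡ c → o ≡ p ⊎ o ≡ q ⊎ o ≡ r) →
    ¬ OffsetArc q p → ¬ OffsetArc r p → ¬ OffsetArc r q → ClassAcyclic (place s F) c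
  triple-acyclic 1≤n p q r member q↛p r↛p r↛q =
    acyclic-by-offset-potential rank λ l₁ l₂ c₁ c₂ → ordered (member l₁ c₁) (member l₂ c₂)
    where
    rank : ℕ → ℕ
    rank o = if does (o ≟ p) then 0 else if does (o ≟ q) then 1 else 2

    rank-pos : ∀ {o} → o ≢ p → 1 ≤ rank o
    rank-pos {o} o≢p rewrite dec-false (o ≟ p) o≢p with does (o ≟ q)
    ... | true  = ≤-refl
    ... | false = s≤s z≤n

    rank-top : ∀ {o} → o ≢ p → o ≢ q → rank o ≡ 2
    rank-top {o} o≢p o≢q rewrite dec-false (o ≟ p) o≢p | dec-false (o ≟ q) o≢q = refl

    Member : ℕ → Set
    Member o = o ≡ p ⊎ o ≡ q ⊎ o ≡ r

    into-p : ∀ {o₁ o₂} → Member o₁ → OffsetArc o₁ o₂ → o₂ ≢ p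
    into-p (inj₁ refl)        arc refl = offset-arc-irrefl 1≤n arc
    into-p (inj₂ (inj₁ refl)) arc refl = q↛p arc
    into-p (inj₂ (inj₂ refl)) arc refl = r↛p arc

    ordered : ∀ {o₁ o₂} → Member o₁ → Member o₂ → OffsetArc o₁ o₂ → rank o₁ < rank o₂
    ordered {o₁} m₁ m₂ arc with o₁ ≟ p
    ... | yes refl rewrite dec-true (o₁ ≟ o₁) refl = rank-pos (into-p m₁ arc)
    ... | no o₁≢p rewrite dec-false (o₁ ≟ p) o₁≢p with m₁ | m₂
    ...   | inj₁ o₁≡p        | _                  = contradiction o₁≡p o₁≢p
    ...   | _                | inj₁ o₂≡p          = contradiction o₂≡p (into-p m₁ arc)
    ...   | inj₂ (inj₁ refl) | inj₂ (inj₁ refl)   = contradiction arc (offset-arc-irrefl 1≤n)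
    ...   | inj₂ (inj₂ refl) | inj₂ (inj₁ refl)   = contradiction arc r↛q
    ...   | inj₂ (inj₂ refl) | inj₂ (inj₂ refl)   = contradiction arc (offset-arc-irrefl 1≤n)
    ...   | inj₂ (inj₁ refl) | inj₂ (inj₂ refl)
      rewrite dec-true (q ≟ q) refl | rank-top (into-p m₁ arc) (λ { refl → offset-arc-irrefl 1≤n arc }) = ≤-refl

  -- Colourings laid out in bands

  adjacent-at : ∀ {s F G} o₀ → o₀ < N n → F o₀ ≢ G o₀ →
                (∀ {o} → o < N n → o ≢ o₀ → F o ≡ G o) → Adj n (place s F) (place s G)
  adjacent-at {s} {F} {G} o₀ o₀<N differ agree = shift n s o₀ ,
    (λ eq → differ (subst (λ o → F o ≡ G o) offset-o₀ (at (shift n s o₀) eq))) ,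
    λ v v≢ → trans (place-offset v) (trans (agree (offset<N s v) (offset-≢ v v≢)) (sym (place-offset v)))
    where
    offset-o₀ : offset s (shift n s o₀) ≡ o₀
    offset-o₀ = trans (offset-shift s o₀) (m<n⇒m%n≡m o₀<N)
    offset-≢ : ∀ v → v ≢ shift n s o₀ → offset s v ≢ o₀
    offset-≢ v v≢ eq = v≢ (trans (sym (shift-offset s v)) (cong (shift n s) eq))
    at : ∀ v → place s F v ≡ place s G v → F (offset s v) ≡ G (offset s v)
    at v eq = trans (sym (place-offset v)) (trans eq (place-offset v))

  module _ {s : V n} {a b c : ℕ} {x y z : Fin 3} where

    bands-a-step : a < b → a < N n → x ≢ y →
                   Adj n (place s (bands a b c x y z)) (place s (bands (suc a) b c x y z))
    bands-a-step a<b a<N x≢y = adjacent-at a a<N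
      (λ eq → x≢y (trans (sym (bands-x ≤-refl a<b)) (trans eq (bands-y₀ (n<1+n a)))))
      λ _ → bands-agree-a

    bands-b-step : a ≤ b → b < c → b < N n → x ≢ y →
                   Adj n (place s (bands a b c x y z)) (place s (bands a (suc b) c x y z))
    bands-b-step a≤b b<c b<N x≢y = adjacent-at b b<N
      (λ eq → x≢y (trans (sym (bands-x a≤b (n<1+n b))) (trans (sym eq) (bands-y₁ a≤b ≤-refl b<c))))
      λ _ → bands-agree-b

    bands-c-step : a ≤ c → b ≤ c → c < N n → y ≢ z →
                   Adj n (place s (bands a b c x y z)) (place s (bands a b (suc c) x y z))
    bands-c-step a≤c b≤c c<N y≢z = adjacent-at c c<N
      (λ eq → y≢z (trans (sym (bands-y₁ a≤c b≤c (n<1+n c))) (trans (sym eq) (bands-z a≤c b≤c ≤-refl))))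
      λ _ → bands-agree-c

    bands-colouring : Distinct x y z → b ≤ a + n → N n ≤ c + n →
      ClassAcyclic (place s (bands a b c x y z)) y → IsColoring n (place s (bands a b c x y z))
    bands-colouring (x≢y , y≢z , x≢z) b≤a+n N≤c+n y-acyclic w with w ≟ᶠ x | w ≟ᶠ y
    ... | yes refl | _ = window-acyclic a λ _ eq → inside-x (bands-inv eq)
      where
      inside-x : ∀ {o} → (o < a ⊎ b ≤ o × o < c) × y ≡ w ⊎ (a ≤ o × o < b) × x ≡ w ⊎ c ≤ o × z ≡ w →
                 a ≤ o × o < a + n
      inside-x (inj₁ (_ , y≡x))                = contradiction (sym y≡x) x≢y
      inside-x (inj₂ (inj₁ ((a≤o , o<b) , _))) = a≤o , ≤-trans o<b b≤a+n
      inside-x (inj₂ (inj₂ (_ , z≡x)))         = contradiction (sym z≡x) x≢z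
    ... | no _ | yes refl = y-acyclic
    ... | no w≢x | no w≢y = window-acyclic c λ o<N eq → inside-z o<N (bands-inv eq)
      where
      inside-z : ∀ {o} → o < N n → (o < a ⊎ b ≤ o × o < c) × y ≡ w ⊎ (a ≤ o × o < b) × x ≡ w ⊎ c ≤ o × z ≡ w →
                 c ≤ o × o < c + n
      inside-z _   (inj₁ (_ , y≡w))         = contradiction (sym y≡w) w≢y
      inside-z _   (inj₂ (inj₁ (_ , x≡w)))  = contradiction (sym x≡w) w≢x
      inside-z o<N (inj₂ (inj₂ (c≤o , _)))  = c≤o , ≤-trans o<N N≤c+n

  bands-middle-acyclic : ∀ {s b c x y z} → y ≢ x → y ≢ z → c ≤ b + n →
                         ClassAcyclic (place s (bands 0 b c x y z)) y
  bands-middle-acyclic {b = b} {c} {x} {y} {z} y≢x y≢z c≤b+n = window-acyclic b λ _ eq → inside (bands-inv eq)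
    where
    inside : ∀ {o} → (o < 0 ⊎ b ≤ o × o < c) × y ≡ y ⊎ (0 ≤ o × o < b) × x ≡ y ⊎ c ≤ o × z ≡ y →
             b ≤ o × o < b + n
    inside (inj₁ (inj₁ () , _))
    inside (inj₁ (inj₂ (b≤o , o<c) , _)) = b≤o , ≤-trans o<c c≤b+n
    inside (inj₂ (inj₁ (_ , x≡y)))        = contradiction (sym x≡y) y≢x
    inside (inj₂ (inj₂ (_ , z≡y)))        = contradiction (sym z≡y) y≢z

  N≤c+n⇒n<c : ∀ {c} → N n ≤ c + n → n < c
  N≤c+n⇒n<c {c} N≤c+n = +-cancelʳ-≤ n (suc n) c N≤c+n

  cuts-colouring : ∀ {s b c x y z} → Distinct x y z → b ≤ n → c ≤ b + n → N n ≤ c + n →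
                   IsColoring n (place s (bands 0 b c x y z))
  cuts-colouring d@(x≢y , y≢z , _) b≤n c≤b+n N≤c+n =
    bands-colouring d b≤n N≤c+n (bands-middle-acyclic (≢-sym x≢y) y≢z c≤b+n)

  bands-colouring-by-triple : 1 ≤ n → ∀ {s a b c x y z} p q r → Distinct x y z → b ≤ a + n → N n ≤ c + n →
    (∀ {o} → o < a ⊎ b ≤ o × o < c → o ≡ p ⊎ o ≡ q ⊎ o ≡ r) →
    ¬ OffsetArc q p → ¬ OffsetArc r p → ¬ OffsetArc r q → IsColoring n (place s (bands a b c x y z))
  bands-colouring-by-triple 1≤n {s} {a} {b} {c} {x} {y} {z} p q r d@(x≢y , y≢z , _) b≤a+n N≤c+n within q↛p r↛p r↛q =
    bands-colouring d b≤a+n N≤c+n (triple-acyclic 1≤n p q r member q↛p r↛p r↛q)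
    where
    member : ∀ {o} → o < N n → bands a b c x y z o ≡ y → o ≡ p ⊎ o ≡ q ⊎ o ≡ r
    member _ eq with bands-inv eq
    ... | inj₁ (o-in-y , _)     = within o-in-y
    ... | inj₂ (inj₁ (_ , x≡y)) = contradiction x≡y x≢y
    ... | inj₂ (inj₂ (_ , z≡y)) = contradiction (sym z≡y) y≢z

  bands-rotate : ∀ {p q r x y z t} → p + q + r ≡ N n → t < N n →
                 bands 0 p (p + q) x y z t ≡ bands 0 q (q + r) y z x ((t + (q + r)) % N n)
  bands-rotate {p} {q} {r} {x} {y} {z} {t} sum t<N with t <? p | t <? p + q
  ... | yes t<p | _ = begin
    bands 0 p (p + q) x y z t                       ≡⟨ bands-x z≤n t<p ⟩
    x                                               ≡⟨ bands-z z≤n (≤-trans (m≤m+n q r) q+r≤) q+r≤ ⟨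
    bands 0 q (q + r) y z x (t + (q + r))           ≡⟨ cong (bands 0 q (q + r) y z x) (m<n⇒m%n≡m t+q+r<N) ⟨
    bands 0 q (q + r) y z x ((t + (q + r)) % N n)   ∎
    where
    open ≡-Reasoning
    q+r≤ : q + r ≤ t + (q + r)
    q+r≤ = m≤n+m (q + r) t
    t+q+r<N : t + (q + r) < N n
    t+q+r<N = subst (t + (q + r) <_) (trans (sym (+-assoc p q r)) sum) (+-monoˡ-< (q + r) t<p)
  ... | no t≮p | yes t<p+q = begin
    bands 0 p (p + q) x y z t                       ≡⟨ bands-y₁ z≤n (≮⇒≥ t≮p) t<p+q ⟩
    y                                               ≡⟨ bands-x z≤n (∸-<-cancel (≮⇒≥ t≮p) t<p+q) ⟨
    bands 0 q (q + r) y z x (t ∸ p)                 ≡⟨ cong (bands 0 q (q + r) y z x) (rotated-offset sum (≮⇒≥ t≮p) t<N) ⟨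
    bands 0 q (q + r) y z x ((t + (q + r)) % N n)   ∎
    where open ≡-Reasoning
  ... | no t≮p | no t≮p+q = begin
    bands 0 p (p + q) x y z t                       ≡⟨ bands-z z≤n (≮⇒≥ t≮p) (≮⇒≥ t≮p+q) ⟩
    z                                               ≡⟨ bands-y₁ z≤n (∸-≤-cancel (≮⇒≥ t≮p) (≮⇒≥ t≮p+q)) t∸p<q+r ⟨
    bands 0 q (q + r) y z x (t ∸ p)                 ≡⟨ cong (bands 0 q (q + r) y z x) (rotated-offset sum (≮⇒≥ t≮p) t<N) ⟨
    bands 0 q (q + r) y z x ((t + (q + r)) % N n)   ∎
    where
    open ≡-Reasoning
    t∸p<q+r : t ∸ p < q + r
    t∸p<q+r = ∸-<-cancel (≮⇒≥ t≮p) (subst (t <_) (trans (sym sum) (+-assoc p q r)) t<N)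

  place-cong : ∀ {s F G} → (∀ o → F o ≡ G o) → place s F ≗ place s G
  place-cong F≗G v = trans (place-offset v) (trans (F≗G _) (sym (place-offset v)))

  hopped-bands : ∀ {s} a {x y z} → place s (bands a (a + n) (n + a) x y z) ≗ place s (bands 0 a (a + n) y x z)
  hopped-bands a {x} {y} {z} = place-cong λ o →
    trans (cong (λ c → bands a (a + n) c x y z o) (+-comm n a)) (bands-merge o)

  -- The y-classes met during a pair hop are {0, n, n + 1}, {0, n + 1} and {0, 1, n + 1}; they
  -- are acyclic because no arc has length n or 2n.
  pair-hop-colourings : 2 ≤ n → ∀ {s x y z} → Distinct x y z →
    IsColoring n (place s (bands 1 n (n + 2) x y z)) ×
    IsColoring n (place s (bands 1 (suc n) (n + 2) x y z)) ×
    IsColoring n (place s (bands 2 (suc n) (n + 2) x y z))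
  pair-hop-colourings 2≤n d =
    bands-colouring-by-triple 1≤n n 0 (suc n) d (n≤1+n n) N≤n+2+n within₁ 0↛n n+1↛n n+1↛0 ,
    bands-colouring-by-triple 1≤n 0 (suc n) (suc n) d ≤-refl N≤n+2+n within₂ n+1↛0 n+1↛0 (offset-arc-irrefl 1≤n) ,
    bands-colouring-by-triple 1≤n 0 (suc n) 1 d (n≤1+n (suc n)) N≤n+2+n within₃ n+1↛0 1↛0 1↛n+1
    where
    1≤n : 1 ≤ n
    1≤n = ≤-trans (s≤s z≤n) 2≤n
    N≤n+2+n : N n ≤ n + 2 + n
    N≤n+2+n = ≤-trans (n≤1+n (N n)) (≤-reflexive (2 + (n + n) ≡ n + 2 + n ∋ solve (n ∷ [])))
    0↛n : ¬ OffsetArc 0 n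
    0↛n = no-arc-of-length-n 1≤n (inj₁ refl)
    n+1↛0 : ¬ OffsetArc (suc n) 0
    n+1↛0 = no-arc-of-length-n 1≤n (inj₂ refl)
    n+1↛n : ¬ OffsetArc (suc n) n
    n+1↛n = no-arc-of-length-2n 2≤n (sym (+-suc n (n + n)))
    1↛0 : ¬ OffsetArc 1 0
    1↛0 = no-arc-of-length-2n 2≤n refl
    1↛n+1 : ¬ OffsetArc 1 (suc n)
    1↛n+1 = no-arc-of-length-n 1≤n (inj₁ refl)
    ≤n+1 : ∀ {o} → o < n + 2 → o ≤ suc n
    ≤n+1 {o} o<n+2 = s≤s⁻¹ (subst (o <_) (+-comm n 2) o<n+2)
    within₁ : ∀ {o} → o < 1 ⊎ n ≤ o × o < n + 2 → o ≡ n ⊎ o ≡ 0 ⊎ o ≡ suc n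
    within₁ (inj₁ (s≤s z≤n)) = inj₂ (inj₁ refl)
    within₁ (inj₂ (n≤o , o<n+2)) with m≤n⇒m<n∨m≡n n≤o
    ... | inj₁ n<o = inj₂ (inj₂ (≤-antisym (≤n+1 o<n+2) n<o))
    ... | inj₂ n≡o = inj₁ (sym n≡o)
    within₂ : ∀ {o} → o < 1 ⊎ suc n ≤ o × o < n + 2 → o ≡ 0 ⊎ o ≡ suc n ⊎ o ≡ suc n
    within₂ (inj₁ (s≤s z≤n)) = inj₁ refl
    within₂ (inj₂ (n<o , o<n+2)) = inj₂ (inj₁ (≤-antisym (≤n+1 o<n+2) n<o))
    within₃ : ∀ {o} → o < 2 ⊎ suc n ≤ o × o < n + 2 → o ≡ 0 ⊎ o ≡ suc n ⊎ o ≡ 1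
    within₃ (inj₁ (s≤s z≤n)) = inj₁ refl
    within₃ (inj₁ (s≤s (s≤s z≤n))) = inj₂ (inj₂ refl)
    within₃ (inj₂ (n<o , o<n+2)) = inj₂ (inj₁ (≤-antisym (≤n+1 o<n+2) n<o))

  -- Walks in the dicolouring graph

  colouring-resp : ∀ {α β} → α ≗ β → IsColoring n β → IsColoring n α
  colouring-resp α≗β β-colouring c (C , coloured) = β-colouring c (C , λ i → trans (sym (α≗β _)) (coloured i))

  adj-resp : ∀ {α α′ γ} → α′ ≗ α → Adj n α γ → Adj n α′ γ
  adj-resp α′≗α (v , differ , agree) =
    v , (λ eq → differ (trans (sym (α′≗α v)) eq)) , λ w w≢v → trans (α′≗α w) (agree w w≢v)

  adj-sym : ∀ {α γ} → Adj n α γ → Adj n γ α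
  adj-sym (v , differ , agree) = v , (λ eq → differ (sym eq)) , λ w w≢v → sym (agree w w≢v)

  walk-resp : ∀ {α α′ β β′ l} → α′ ≗ α → Walk n α β l → β ≗ β′ → Walk n α′ β′ l
  walk-resp α′≗α (done α≗β) β≗β′ = done λ v → trans (α′≗α v) (trans (α≗β v) (β≗β′ v))
  walk-resp α′≗α (step γ-colouring adj w) β≗β′ = step γ-colouring (adj-resp α′≗α adj) (walk-resp (λ _ → refl) w β≗β′)

  infixr 5 _++ʷ_
  _++ʷ_ : ∀ {α β γ l m} → Walk n α β l → Walk n β γ m → Walk n α γ (l + m)
  done α≗β ++ʷ w = walk-resp α≗β w λ _ → refl
  step γ-colouring adj w ++ʷ w′ = step γ-colouring adj (w ++ʷ w′)

  reverse : ∀ {α β l} → IsColoring n α → Walk n α β l → Walk n β α l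
  reverse α-colouring (done α≗β) = done λ v → sym (α≗β v)
  reverse {α} α-colouring (step {l = l} γ-colouring adj w) =
    subst (Walk n _ α) (+-comm l 1) (reverse γ-colouring w ++ʷ step α-colouring (adj-sym adj) (done λ _ → refl))

  -- Three-block colourings and the moves between them

  advance-b : ∀ {s b c x y z} k → Distinct x y z → k + b ≤ n → c ≤ b + n → N n ≤ c + n →
              Walk n (place s (bands 0 b c x y z)) (place s (bands 0 (k + b) c x y z)) k
  advance-b zero _ _ _ _ = done λ _ → refl
  advance-b {s} {b} {c} {x} {y} {z} (suc k) d@(x≢y , _) k+1+b≤n c≤b+n N≤c+n =
    step (cuts-colouring d b<n c≤b+1+n N≤c+n)
         (bands-b-step z≤n (<-trans b<n (N≤c+n⇒n<c N≤c+n)) (<-trans b<n n<N) x≢y)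
         (subst (λ t → Walk n (place s (bands 0 (suc b) c x y z)) (place s (bands 0 t c x y z)) k) (+-suc k b)
                (advance-b k d (subst (_≤ n) (sym (+-suc k b)) k+1+b≤n) c≤b+1+n N≤c+n))
    where
    b<n : b < n
    b<n = ≤-trans (s≤s (m≤n+m b k)) k+1+b≤n
    c≤b+1+n : c ≤ suc b + n
    c≤b+1+n = ≤-trans c≤b+n (n≤1+n _)

  advance-c : ∀ {s b c x y z} k → Distinct x y z → b ≤ n → k + c ≤ b + n → N n ≤ c + n →
              Walk n (place s (bands 0 b c x y z)) (place s (bands 0 b (k + c) x y z)) k
  advance-c zero _ _ _ _ = done λ _ → refl
  advance-c {s} {b} {c} {x} {y} {z} (suc k) d@(_ , y≢z , _) b≤n k+1+c≤b+n N≤c+n =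
    step (cuts-colouring d b≤n c<b+n N≤c+1+n)
         (bands-c-step z≤n (≤-trans b≤n (<⇒≤ (N≤c+n⇒n<c N≤c+n)))
                       (<-≤-trans c<b+n (≤-trans (+-monoˡ-≤ n b≤n) (n≤1+n (n + n)))) y≢z)
         (subst (λ t → Walk n (place s (bands 0 b (suc c) x y z)) (place s (bands 0 b t x y z)) k) (+-suc k c)
                (advance-c k d b≤n (subst (_≤ b + n) (sym (+-suc k c)) k+1+c≤b+n) N≤c+1+n))
    where
    c<b+n : c < b + n
    c<b+n = ≤-trans (s≤s (m≤n+m c k)) k+1+c≤b+n
    N≤c+1+n : N n ≤ suc c + n
    N≤c+1+n = ≤-trans N≤c+n (n≤1+n _)

  ≡n⇒e+[k+1]≡n : ∀ e k → suc (e + k) ≡ n → e + (k + 1) ≡ n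
  ≡n⇒e+[k+1]≡n e k 1+e+k≡n = trans (e + (k + 1) ≡ 1 + (e + k) ∋ solve (e ∷ k ∷ [])) 1+e+k≡n

  ≡n⇒k+1≤n : ∀ e k → suc (e + k) ≡ n → k + 1 ≤ n
  ≡n⇒k+1≤n e k 1+e+k≡n = subst (k + 1 ≤_) (≡n⇒e+[k+1]≡n e k 1+e+k≡n) (m≤n+m (k + 1) e)

  N≤p+n+n : ∀ {p} → 1 ≤ p → N n ≤ p + n + n
  N≤p+n+n 1≤p = +-monoˡ-≤ n (+-monoˡ-≤ n 1≤p)

  Near : Fin 3 → Fin 3 → Col n → Col n → Set
  Near x d α β = DistLe n α β (3 * n ∸ 1) × (x ≢ d → DistLe n α β (2 * n + 1))

  ≤3n∸1 : ∀ {l} → l + 1 ≤ 3 * n → l ≤ 3 * n ∸ 1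
  ≤3n∸1 {l} l+1≤3n = subst (_≤ 3 * n ∸ 1) (m+n∸n≡m l 1) (∸-monoˡ-≤ 1 l+1≤3n)

  near-same : ∀ {x α β l} → Walk n α β l → l + 1 ≤ 3 * n → Near x x α β
  near-same {l = l} w l+1≤3n = (l , ≤3n∸1 l+1≤3n , w) , λ x≢x → contradiction refl x≢x

  near-apart : ∀ {x d α β l} → 2 ≤ n → Walk n α β l → l ≤ 2 * n + 1 → Near x d α β
  near-apart {l = l} 2≤n w l≤2n+1 = (l , ≤-trans l≤2n+1 (≤3n∸1 2n+2≤3n) , w) , λ _ → l , l≤2n+1 , w
    where
    2n+2≤3n : 2 * n + 1 + 1 ≤ 3 * n
    2n+2≤3n = subst₂ _≤_ (sym (+-assoc (2 * n) 1 1)) (2 * n + n ≡ 3 * n ∋ solve (n ∷ [])) (+-monoʳ-≤ (2 * n) 2≤n)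

  near-resp : ∀ {x d α α′ β β′} → α′ ≗ α → β ≗ β′ → Near x d α β → Near x d α′ β′
  near-resp α′≗α β≗β′ ((l , l≤ , w) , apart) =
    (l , l≤ , walk-resp α′≗α w β≗β′) , λ x≢d → let (l′ , l′≤ , w′) = apart x≢d in l′ , l′≤ , walk-resp α′≗α w′ β≗β′

  near-sym : ∀ {x d α β} → IsColoring n α → Near x d α β → Near d x β α
  near-sym α-colouring ((l , l≤ , w) , apart) =
    (l , l≤ , reverse α-colouring w) ,
    λ d≢x → let (l′ , l′≤ , w′) = apart (≢-sym d≢x) in l′ , l′≤ , reverse α-colouring w′

  module Blocks (origin : V n) where

    blocks : ℕ → ℕ → ℕ → Fin 3 → Fin 3 → Fin 3 → Col n
    blocks u p q x y z = place (shift n origin u) (bands 0 p (p + q) x y z)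

    blocks-colouring : ∀ {u p q x y z} → Distinct x y z → p ≤ n → q ≤ n → N n ≤ p + q + n →
                       IsColoring n (blocks u p q x y z)
    blocks-colouring d p≤n q≤n N≤p+q+n = cuts-colouring d p≤n (+-monoʳ-≤ _ q≤n) N≤p+q+n

    blocks-wrap : ∀ {u u′ p q x y z} → u′ ≡ u + N n → blocks u′ p q x y z ≗ blocks u p q x y z
    blocks-wrap {u} {p = p} {q} {x} {y} {z} refl v =
      cong (λ s → place s (bands 0 p (p + q) x y z) v) (shift-% origin ([m+n]%n≡m%n u (N n)))

    rotate : ∀ {u p q r x y z} → p + q + r ≡ N n → blocks u p q x y z ≗ blocks (u + p) q r y z x
    rotate {u} {p} {q} {r} {x} {y} {z} sum v = begin
      blocks u p q x y z v                                   ≡⟨ place-offset v ⟩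
      bands 0 p (p + q) x y z (offset s v)                   ≡⟨ bands-rotate sum (offset<N s v) ⟩
      bands 0 q (q + r) y z x ((offset s v + (q + r)) % N n) ≡⟨ cong (bands 0 q (q + r) y z x) rebased ⟨
      bands 0 q (q + r) y z x (offset (shift n s p) v)       ≡⟨ place-offset v ⟨
      place (shift n s p) (bands 0 q (q + r) y z x) v        ≡⟨ cong (λ s′ → place s′ _ v) (shift-+ origin u p) ⟩
      blocks (u + p) q r y z x v                             ∎
      where
      open ≡-Reasoning
      s : V n
      s = shift n origin u
      rebased : offset (shift n s p) v ≡ (offset s v + (q + r)) % N n
      rebased = offset-rebase s v (trans (sym (+-assoc p q r)) sum)

    advance-y : ∀ {u p q x y z} k → Distinct x y z → k + p ≤ n → k + q ≤ n → N n ≤ p + (k + q) + n →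
                Walk n (blocks u p (k + q) x y z) (blocks u (k + p) q x y z) k
    advance-y {u} {p} {q} {x} {y} {z} k d k+p≤n k+q≤n N≤ =
      subst (λ c → Walk n (blocks u p (k + q) x y z) (place (shift n origin u) (bands 0 (k + p) c x y z)) k)
            (p + (k + q) ≡ k + p + q ∋ solve (p ∷ k ∷ q ∷ []))
            (advance-b k d k+p≤n (+-monoʳ-≤ p k+q≤n) N≤)

    advance-z : ∀ {u p q x y z} k → Distinct x y z → p ≤ n → k + q ≤ n → N n ≤ p + q + n →
                Walk n (blocks u p q x y z) (blocks u p (k + q) x y z) k
    advance-z {u} {p} {q} {x} {y} {z} k d p≤n k+q≤n N≤ =
      subst (λ c → Walk n (blocks u p q x y z) (place (shift n origin u) (bands 0 p c x y z)) k)
            (k + (p + q) ≡ p + (k + q) ∋ solve (k ∷ p ∷ q ∷ []))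
            (advance-c k d p≤n (subst (_≤ p + n) (p + (k + q) ≡ k + (p + q) ∋ solve (p ∷ k ∷ q ∷ [])) (+-monoʳ-≤ p k+q≤n)) N≤)

    -- Seen from the start of the z-block, moving the start of the x-block is advance-y.
    advance-x : ∀ {u p q x y z} k → Distinct x y z → k + p ≤ n → q ≤ n → N n ≤ p + q + n →
                Walk n (blocks u (k + p) q x y z) (blocks (u + k) p q x y z) k
    advance-x {u} {p} {q} k d k+p≤n q≤n N≤p+q+n
      with m≤n⇒∃[o]m+o≡n (≤-trans (+-mono-≤ k+p≤n q≤n) (n≤1+n (n + n)))
    ... | r , sum =
      walk-resp (λ v → trans (rotate sum v) (rotate sum′ v))
                (advance-y k (distinct-zxy d) k+r≤n k+p≤n N≤r+[k+p]+n)
                (λ v → trans (rotate sum″ v) (blocks-wrap around v))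
      where
      open ≤-Reasoning
      sum′ : q + r + (k + p) ≡ N n
      sum′ = trans (q + r + (k + p) ≡ k + p + q + r ∋ solve (q ∷ r ∷ k ∷ p ∷ [])) sum
      sum″ : k + r + p + q ≡ N n
      sum″ = trans (k + r + p + q ≡ k + p + q + r ∋ solve (k ∷ r ∷ p ∷ q ∷ [])) sum
      k+r≤n : k + r ≤ n
      k+r≤n = +-cancelʳ-≤ (p + q) (k + r) n (begin
        k + r + (p + q) ≡⟨ trans (k + r + (p + q) ≡ k + p + q + r ∋ solve (k ∷ r ∷ p ∷ q ∷ [])) sum ⟩
        N n             ≤⟨ N≤p+q+n ⟩
        p + q + n       ≡⟨ +-comm (p + q) n ⟩
        n + (p + q)     ∎)
      N≤r+[k+p]+n : N n ≤ r + (k + p) + n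
      N≤r+[k+p]+n = begin
        N n             ≡⟨ trans (r + (k + p) + q ≡ k + p + q + r ∋ solve (r ∷ k ∷ p ∷ q ∷ [])) sum ⟨
        r + (k + p) + q ≤⟨ +-monoʳ-≤ (r + (k + p)) q≤n ⟩
        r + (k + p) + n ∎
      around : u + (k + p) + q + (k + r) ≡ u + k + N n
      around = trans (u + (k + p) + q + (k + r) ≡ u + k + (k + p + q + r) ∋ solve (u ∷ k ∷ p ∷ q ∷ r ∷ []))
                     (cong (u + k +_) sum)

    -- The colourings of 𝒞, with the singleton {origin + u} coloured x.
    standard : ℕ → Fin 3 → Fin 3 → Fin 3 → Col n
    standard u x y z = blocks u 1 n x y z

    standard-colouring : ∀ {u x y z} → 1 ≤ n → Distinct x y z → IsColoring n (standard u x y z)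
    standard-colouring 1≤n d = blocks-colouring d 1≤n ≤-refl ≤-refl

    -- The singleton y jumps over the x-block: 0 turns y (the y-class {0, n} is acyclic since
    -- there is no arc from 0 to n), then n turns x.
    hop : ∀ {u x y z} → 1 ≤ n → Distinct x y z → Walk n (blocks u n 1 x y z) (standard u y x z) 2
    hop 1≤n d@(x≢y , _) =
      step (bands-colouring-by-triple 1≤n n 0 0 d (n≤1+n n) (≤-reflexive (sym (trans (+-assoc n 1 n) (+-suc n n))))
                                      within 0↛n 0↛n (offset-arc-irrefl 1≤n))
           (bands-a-step 1≤n (s≤s z≤n) x≢y)
      (step (colouring-resp (hopped-bands 1) (standard-colouring 1≤n (distinct-yxz d)))
            (bands-b-step 1≤n (subst (n <_) (sym (+-comm n 1)) (n<1+n n)) n<N x≢y)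
      (done (hopped-bands 1)))
      where
      0↛n : ¬ OffsetArc 0 n
      0↛n = no-arc-of-length-n 1≤n (inj₁ refl)
      within : ∀ {o} → o < 1 ⊎ n ≤ o × o < n + 1 → o ≡ n ⊎ o ≡ 0 ⊎ o ≡ 0
      within (inj₁ (s≤s z≤n)) = inj₂ (inj₁ refl)
      within {o} (inj₂ (n≤o , o<n+1)) = inj₁ (≤-antisym (s≤s⁻¹ (subst (o <_) (+-comm n 1) o<n+1)) n≤o)

    pair-hop : ∀ {u x y z} → 2 ≤ n → Distinct x y z → Walk n (blocks u n 2 x y z) (blocks u 2 n y x z) 4
    pair-hop 2≤n d@(x≢y , _) with pair-hop-colourings 2≤n d
    ... | first , second , third =
      step first (bands-a-step 1≤n (s≤s z≤n) x≢y)
      (step second (bands-b-step 1≤n (subst (n <_) (sym (+-comm n 2)) (≤-trans (n<1+n n) (n≤1+n (suc n)))) n<N x≢y)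
      (step third (bands-a-step (s≤s 1≤n) (s≤s (≤-trans 1≤n (m≤m+n n n))) x≢y)
      (step (colouring-resp (hopped-bands 2) (blocks-colouring (distinct-yxz d) 2≤n ≤-refl (n≤1+n (N n))))
            (bands-b-step (s≤s 1≤n) (subst (suc n <_) (sym (+-comm n 2)) (n<1+n (suc n)))
                          (s≤s (subst (_≤ n + n) (+-comm n 1) (+-monoʳ-≤ n 1≤n))) x≢y)
      (done (hopped-bands 2)))))
      where
      1≤n : 1 ≤ n
      1≤n = ≤-trans (s≤s z≤n) 2≤n

    blocks-n-1 : ∀ {u x y z} → blocks u n 1 x y z ≗ standard (u + n) y z x
    blocks-n-1 = rotate (n + 1 + n ≡ 1 + (n + n) ∋ solve (n ∷ []))

    blocks-n-n : ∀ {u x y z} → blocks u n n x y z ≗ standard (u + n + n) z x y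
    blocks-n-n v = trans (rotate (n + n + 1 ≡ 1 + (n + n) ∋ solve (n ∷ [])) v) (blocks-n-1 v)

    standard-as-blocks-n-n : ∀ {u x y z} → standard u x y z ≗ blocks (u + 1) n n y z x
    standard-as-blocks-n-n = rotate refl

    slide : ∀ {u x y z} e k → e + suc k ≡ n → Distinct x y z →
            Walk n (standard u x y z) (standard (u + e) x y z) (e + (e + e))
    slide {u} {x} {y} {z} e k e+k+1≡n d =
      walk-resp (λ v → cong (λ m → blocks u 1 m x y z v) (sym e+k+1≡n))
        (advance-y e d e+1≤n e+k+1≤n N≤1+[e+k+1]+n
         ++ʷ advance-z e d e+1≤n e+k+1≤n N≤[e+1]+[k+1]+n
         ++ʷ advance-x e d e+1≤n e+k+1≤n N≤1+[e+k+1]+n)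
        (λ v → cong (λ m → blocks (u + e) 1 m x y z v) e+k+1≡n)
      where
      e+1≤n : e + 1 ≤ n
      e+1≤n = subst (e + 1 ≤_) e+k+1≡n (+-monoʳ-≤ e (s≤s z≤n))
      e+k+1≤n : e + suc k ≤ n
      e+k+1≤n = ≤-reflexive e+k+1≡n
      N≤1+[e+k+1]+n : N n ≤ 1 + (e + suc k) + n
      N≤1+[e+k+1]+n = ≤-reflexive (cong (λ t → suc (t + n)) (sym e+k+1≡n))
      N≤[e+1]+[k+1]+n : N n ≤ e + 1 + suc k + n
      N≤[e+1]+[k+1]+n = subst (N n ≤_) (cong (_+ n) (1 + (e + suc k) ≡ e + 1 + suc k ∋ solve (e ∷ k ∷ []))) N≤1+[e+k+1]+n

    hop-back : ∀ {u x y z} → 1 ≤ n → Distinct x y z → Walk n (standard u x y z) (standard (u + suc n) x z y) 2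
    hop-back {u} {x} {y} {z} 1≤n d =
      walk-resp (λ v → trans (standard-as-blocks-n-n v) (rotate (n + n + 1 ≡ 1 + (n + n) ∋ solve (n ∷ [])) v))
                (hop 1≤n (distinct-zxy d))
                (λ v → cong (λ t → standard t x z y v) (+-assoc u 1 n))

    hop-forward : ∀ {u x y z} → 1 ≤ n → Distinct x y z → Walk n (standard u x y z) (standard (u + n) x z y) 2
    hop-forward 1≤n d =
      walk-resp (λ _ → refl)
                (reverse (blocks-colouring (distinct-yxz d) ≤-refl 1≤n (≤-reflexive (1 + (n + n) ≡ n + 1 + n ∋ solve (n ∷ []))))
                         (hop 1≤n (distinct-yxz d)))
                blocks-n-1

    -- The x-block grows backwards by k and then forwards by e, up to n vertices.
    stretch : ∀ {u x y z} e k → suc (e + k) ≡ n → Distinct x y z →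
              Walk n (standard u x y z) (blocks (u + suc n + suc e) (e + (k + 1)) (k + 1) x y z) (k + e)
    stretch {u} {x} {y} {z} e k 1+e+k≡n d =
      walk-resp (λ v → sym (blocks-wrap around v))
        (reverse (blocks-colouring d k+1≤n ≤-refl (+-monoˡ-≤ n (+-monoˡ-≤ n (m≤n+m 1 k))))
                 (advance-x k d k+1≤n ≤-refl ≤-refl))
        (λ v → cong (λ m → blocks (u + suc n + suc e) (k + 1) m x y z v) (sym e+[k+1]≡n))
      ++ʷ advance-y e d (≤-reflexive e+[k+1]≡n) (≤-reflexive e+[k+1]≡n)
                      (subst (λ m → N n ≤ k + 1 + m + n) (sym e+[k+1]≡n) (+-monoˡ-≤ n (+-monoˡ-≤ n (m≤n+m 1 k))))
      where
      e+[k+1]≡n : e + (k + 1) ≡ n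
      e+[k+1]≡n = ≡n⇒e+[k+1]≡n e k 1+e+k≡n
      k+1≤n : k + 1 ≤ n
      k+1≤n = ≡n⇒k+1≤n e k 1+e+k≡n
      around : u + suc n + suc e + k ≡ u + N n
      around = trans (u + (1 + n) + (1 + e) + k ≡ u + (1 + (n + (1 + (e + k)))) ∋ solve (u ∷ n ∷ e ∷ k ∷ []))
                     (cong (λ t → u + (1 + (n + t))) 1+e+k≡n)

    cycle-yzx : ∀ {u x y z} e k → suc (e + k) ≡ n → Distinct x y z →
                Walk n (standard u x y z) (standard (u + suc e) y z x) (k + e + k)
    cycle-yzx {u} {x} {y} {z} e k 1+e+k≡n d =
      stretch e k 1+e+k≡n d
      ++ʷ walk-resp (λ _ → refl)
            (reverse (blocks-colouring d P≤n (subst (1 ≤_) 1+e+k≡n (s≤s z≤n)) N≤P+1+n)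
                     (advance-z k d P≤n (≡n⇒k+1≤n e k 1+e+k≡n) N≤P+1+n))
            (λ v → trans (cong (λ p → blocks v₀ p 1 x y z v) (≡n⇒e+[k+1]≡n e k 1+e+k≡n))
                         (trans (blocks-n-1 v) (blocks-wrap around v)))
      where
      v₀ : ℕ
      v₀ = u + suc n + suc e
      P≤n : e + (k + 1) ≤ n
      P≤n = ≤-reflexive (≡n⇒e+[k+1]≡n e k 1+e+k≡n)
      N≤P+1+n : N n ≤ e + (k + 1) + 1 + n
      N≤P+1+n = ≤-reflexive (subst (λ p → N n ≡ p + 1 + n) (sym (≡n⇒e+[k+1]≡n e k 1+e+k≡n))
                                   (1 + (n + n) ≡ n + 1 + n ∋ solve (n ∷ [])))
      around : v₀ + n ≡ u + suc e + N n
      around = u + (1 + n) + (1 + e) + n ≡ u + (1 + e) + (1 + (n + n)) ∋ solve (u ∷ n ∷ e ∷ [])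

    cycle-zxy : ∀ {u x y z} e k → suc (e + k) ≡ n → Distinct x y z →
                Walk n (standard u x y z) (standard (u + n + suc e) z x y) (k + e + e)
    cycle-zxy {u} {x} {y} {z} e k 1+e+k≡n d =
      stretch e k 1+e+k≡n d
      ++ʷ walk-resp (λ _ → refl)
            (advance-z e d (≤-reflexive P≡n) (≤-reflexive P≡n) N≤P+[k+1]+n)
            (λ v → trans (cong (λ p → blocks v₀ p p x y z v) P≡n) (trans (blocks-n-n v) (blocks-wrap around v)))
      where
      v₀ : ℕ
      v₀ = u + suc n + suc e
      P≡n : e + (k + 1) ≡ n
      P≡n = ≡n⇒e+[k+1]≡n e k 1+e+k≡n
      N≤P+[k+1]+n : N n ≤ e + (k + 1) + (k + 1) + n
      N≤P+[k+1]+n = subst (λ p → N n ≤ p + (k + 1) + n) (sym P≡n)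
        (≤-trans (≤-reflexive (1 + (n + n) ≡ n + 1 + n ∋ solve (n ∷ [])))
                 (+-monoˡ-≤ n (+-monoʳ-≤ n (m≤n+m 1 k))))
      around : v₀ + n + n ≡ u + n + suc e + N n
      around = u + (1 + n) + (1 + e) + n + n ≡ u + n + (1 + e) + (1 + (n + n)) ∋ solve (u ∷ n ∷ e ∷ [])

    -- slide cannot move the singleton by n, as its block would reach n + 1 vertices.  Instead the
    -- x-block grows backwards to n − 1 vertices, the z-pair behind it hops over the y-block, and
    -- after regrowing the blocks the singleton x hops back: 3n − 1 recolourings in all.
    pair-hop-phase : ∀ {u x y z} m → n ≡ 3 + m → Distinct x y z →
                     Walk n (standard u x y z) (blocks u 3 n z y x) (m + 1 + (4 + 1))
    pair-hop-phase {u} m n≡3+m d =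
      walk-resp (λ v → sym (blocks-wrap around v))
        (reverse (blocks-colouring {u = v} d m+2≤n ≤-refl (N≤p+n+n (m≤n+m 1 (m + 1))))
                 (advance-x {u = v} (m + 1) d m+2≤n ≤-refl ≤-refl))
        (rotate sum)
      ++ʷ walk-resp (λ _ → refl) (pair-hop 2≤n (distinct-yzx d)) (blocks-wrap around′)
      ++ʷ reverse (blocks-colouring (distinct-zyx d) 3≤n ≤-refl (N≤p+n+n (s≤s z≤n)))
                  (advance-x 1 (distinct-zyx d) 3≤n ≤-refl (N≤p+n+n (s≤s z≤n)))
      where
      v : ℕ
      v = u + n + 3
      3≤n : 3 ≤ n
      3≤n = subst (3 ≤_) (sym n≡3+m) (m≤m+n 3 m)
      2≤n : 2 ≤ n
      2≤n = ≤-trans (n≤1+n 2) 3≤n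
      m+2≤n : m + 1 + 1 ≤ n
      m+2≤n = ≤-by 1 (trans (m + 1 + 1 + 1 ≡ 3 + m ∋ solve (m ∷ [])) (sym n≡3+m))
      sum : m + 1 + 1 + n + 2 ≡ N n
      sum = trans (m + 1 + 1 + n + 2 ≡ 1 + (n + (3 + m)) ∋ solve (m ∷ n ∷ [])) (cong (λ t → 1 + (n + t)) (sym n≡3+m))
      around : u + n + 3 + (m + 1) ≡ u + N n
      around = trans (u + n + 3 + (m + 1) ≡ u + (1 + (n + (3 + m))) ∋ solve (u ∷ n ∷ m ∷ []))
                     (cong (λ t → u + (1 + (n + t))) (sym n≡3+m))
      around′ : u + n + 3 + (m + 1 + 1) ≡ u + 1 + N n
      around′ = trans (u + n + 3 + (m + 1 + 1) ≡ u + 1 + (1 + (n + (3 + m))) ∋ solve (u ∷ n ∷ m ∷ []))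
                      (cong (λ t → u + 1 + (1 + (n + t))) (sym n≡3+m))

    hop-phase : ∀ {u x y z} m → n ≡ 3 + m → Distinct x y z →
                Walk n (blocks u 3 n z y x) (standard (u + n) x y z) (m + m + 2)
    hop-phase {u} {x} {y} {z} m n≡3+m d =
      walk-resp (λ v → cong (λ t → blocks u 3 t z y x v) n≡m+3)
        (advance-y m (distinct-zyx d) m+3≤n m+3≤n (subst (λ t → N n ≤ 3 + t + n) n≡m+3 (N≤p+n+n (s≤s z≤n)))
         ++ʷ advance-z m (distinct-zyx d) m+3≤n m+3≤n (subst (λ t → N n ≤ t + 3 + n) n≡m+3 N≤n+3+n))
        (λ v → trans (cong (λ t → blocks u t t z y x v) (sym n≡m+3)) (blocks-n-n v))
      ++ʷ walk-resp (λ _ → refl) (hop-back 1≤n (distinct-xzy d)) (blocks-wrap around)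
      where
      n≡m+3 : n ≡ m + 3
      n≡m+3 = trans n≡3+m (+-comm 3 m)
      m+3≤n : m + 3 ≤ n
      m+3≤n = ≤-reflexive (sym n≡m+3)
      1≤n : 1 ≤ n
      1≤n = subst (1 ≤_) (sym n≡3+m) (s≤s z≤n)
      N≤n+3+n : N n ≤ n + 3 + n
      N≤n+3+n = subst (λ t → N n ≤ t + n) (+-comm 3 n) (N≤p+n+n (s≤s z≤n))
      around : u + n + n + suc n ≡ u + n + N n
      around = u + n + n + (1 + n) ≡ u + n + (1 + (n + n)) ∋ solve (u ∷ n ∷ [])

    slide-by-n : ∀ {u x y z} m → n ≡ 3 + m → Distinct x y z →
                 Walk n (standard u x y z) (standard (u + n) x y z) (m + 1 + (4 + 1) + (m + m + 2))
    slide-by-n m n≡3+m d = pair-hop-phase m n≡3+m d ++ʷ hop-phase m n≡3+m d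

    module _ (m : ℕ) (n≡3+m : n ≡ 3 + m) where

      private
        1≤n : 1 ≤ n
        1≤n = subst (1 ≤_) (sym n≡3+m) (s≤s z≤n)
        2≤n : 2 ≤ n
        2≤n = subst (2 ≤_) (sym n≡3+m) (s≤s (s≤s z≤n))
        1+[2+m+0]≡n : suc (2 + m + 0) ≡ n
        1+[2+m+0]≡n = trans (cong (3 +_) (+-identityʳ m)) (sym n≡3+m)
        1+[1+[1+m]]≡n : 1 + suc (1 + m) ≡ n
        1+[1+[1+m]]≡n = sym n≡3+m
        1+[0+[2+m]]≡n : suc (0 + (2 + m)) ≡ n
        1+[0+[2+m]]≡n = sym n≡3+m
        3n : ∀ {a} → a ≡ 3 * (3 + m) → a ≡ 3 * n
        3n eq = trans eq (cong (3 *_) (sym n≡3+m))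
        2n+1 : ∀ {a} → a ≡ 2 * (3 + m) + 1 → a ≡ 2 * n + 1
        2n+1 eq = trans eq (cong (λ t → 2 * t + 1) (sym n≡3+m))

      pass : ∀ {u x y z} → Distinct x y z → Walk n (standard u x y z) (standard (u + n) y z x) (2 + m + 0)
      pass {u} {x} {y} {z} d =
        walk-resp (λ _ → refl) (cycle-yzx (2 + m) 0 1+[2+m+0]≡n d) (λ v → cong (λ t → standard (u + t) y z x v) (sym n≡3+m))

      near-xyz : ∀ {e x y z} → e ≤ n → Distinct x y z → Near x x (standard 0 x y z) (standard e x y z)
      near-xyz {e} e≤n d with m≤n⇒m<n∨m≡n e≤n
      ... | inj₂ refl = near-same (slide-by-n m n≡3+m d)
        (≤-reflexive (3n (m + 1 + (4 + 1) + (m + m + 2) + 1 ≡ 3 * (3 + m) ∋ solve (m ∷ []))))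
      ... | inj₁ e<n with m≤n⇒∃[o]m+o≡n e<n
      ...   | k , 1+e+k≡n = near-same (slide e k (trans (+-suc e k) 1+e+k≡n) d)
        (≤-by (2 + 3 * k) (trans (e + (e + e) + 1 + (2 + 3 * k) ≡ 3 * (1 + e + k) ∋ solve (e ∷ k ∷ []))
                                 (cong (3 *_) 1+e+k≡n)))

      near-xzy : ∀ {e x y z} → e ≤ n → Distinct x y z → Near x x (standard 0 x y z) (standard e x z y)
      near-xzy {zero} _ d = near-same
        (pass d ++ʷ pass (distinct-yzx d) ++ʷ walk-resp (λ _ → refl) (hop-back 1≤n (distinct-zxy d)) (blocks-wrap around)
         ++ʷ reverse (standard-colouring 1≤n (distinct-xzy d)) (pass (distinct-xzy d)))
        (≤-reflexive (3n (2 + m + 0 + (2 + m + 0 + (2 + (2 + m + 0))) + 1 ≡ 3 * (3 + m) ∋ solve (m ∷ []))))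
        where
        around : n + n + suc n ≡ n + N n
        around = n + n + (1 + n) ≡ n + (1 + (n + n)) ∋ solve (n ∷ [])
      near-xzy {suc e} e<n d with m≤n⇒∃[o]m+o≡n e<n
      ... | k , 1+e+k≡n = near-same
        (walk-resp (λ v → sym (blocks-wrap around v))
                   (reverse (standard-colouring 1≤n d) (slide k e (trans (+-comm k (suc e)) 1+e+k≡n) d))
                   (λ _ → refl)
         ++ʷ walk-resp (λ _ → refl) (hop-forward 1≤n d) (blocks-wrap around′))
        (≤-by (3 * e) (trans (k + (k + k) + 2 + 1 + 3 * e ≡ 3 * (1 + e + k) ∋ solve (k ∷ e ∷ []))
                             (cong (3 *_) 1+e+k≡n)))
        where
        around : suc e + suc n + k ≡ 0 + N n
        around = trans ((1 + e) + (1 + n) + k ≡ 1 + (n + (1 + e + k)) ∋ solve (e ∷ n ∷ k ∷ []))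
                       (cong (λ t → 1 + (n + t)) 1+e+k≡n)
        around′ : suc e + suc n + n ≡ suc e + N n
        around′ = (1 + e) + (1 + n) + n ≡ (1 + e) + (1 + (n + n)) ∋ solve (e ∷ n ∷ [])

      near-yxz : ∀ {e x y z} → e ≤ n → Distinct x y z → Near x y (standard 0 x y z) (standard e y x z)
      near-yxz {zero} _ d = near-apart 2≤n
        (pass d ++ʷ walk-resp (λ _ → refl) (hop-back 1≤n (distinct-yzx d)) (blocks-wrap around))
        (≤-by (3 + m) (2n+1 (2 + m + 0 + 2 + (3 + m) ≡ 2 * (3 + m) + 1 ∋ solve (m ∷ []))))
        where
        around : n + suc n ≡ 0 + N n
        around = +-suc n n
      near-yxz {suc e} e<n d with m≤n⇒∃[o]m+o≡n e<n
      ... | k , 1+e+k≡n = near-apart 2≤n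
        (hop-back 1≤n d ++ʷ walk-resp (λ _ → refl) (cycle-zxy e k 1+e+k≡n (distinct-xzy d)) (blocks-wrap around))
        (≤-by (1 + k) (trans (2 + (k + e + e) + (1 + k) ≡ 2 * (1 + e + k) + 1 ∋ solve (k ∷ e ∷ []))
                             (cong (λ t → 2 * t + 1) 1+e+k≡n)))
        where
        around : suc n + n + suc e ≡ suc e + N n
        around = (1 + n) + n + (1 + e) ≡ (1 + e) + (1 + (n + n)) ∋ solve (n ∷ e ∷ [])

      near-yzx : ∀ {e x y z} → e ≤ n → Distinct x y z → Near x y (standard 0 x y z) (standard e y z x)
      near-yzx {zero} _ d = near-apart 2≤n
        (walk-resp (λ v → sym (blocks-wrap around v))
                   (reverse (standard-colouring 1≤n d) (slide 1 (1 + m) 1+[1+[1+m]]≡n d)) (λ _ → refl)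
         ++ʷ walk-resp (λ _ → refl) (cycle-yzx 0 (2 + m) 1+[0+[2+m]]≡n d) (blocks-wrap around))
        (≤-reflexive (2n+1 (1 + (1 + 1) + (2 + m + 0 + (2 + m)) ≡ 2 * (3 + m) + 1 ∋ solve (m ∷ []))))
        where
        around : n + n + 1 ≡ 0 + N n
        around = n + n + 1 ≡ 1 + (n + n) ∋ solve (n ∷ [])
      near-yzx {suc e} e<n d with m≤n⇒∃[o]m+o≡n e<n
      ... | k , 1+e+k≡n = near-apart 2≤n (cycle-yzx e k 1+e+k≡n d)
        (≤-by (3 + e) (trans (k + e + k + (3 + e) ≡ 2 * (1 + e + k) + 1 ∋ solve (k ∷ e ∷ []))
                             (cong (λ t → 2 * t + 1) 1+e+k≡n)))

      near-zxy : ∀ {e x y z} → e ≤ n → Distinct x y z → Near x z (standard 0 x y z) (standard e z x y)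
      near-zxy {zero} _ d = near-apart 2≤n
        (slide 1 (1 + m) 1+[1+[1+m]]≡n d
         ++ʷ reverse (standard-colouring 1≤n (distinct-zxy d)) (cycle-yzx 0 (2 + m) 1+[0+[2+m]]≡n (distinct-zxy d)))
        (≤-reflexive (2n+1 (1 + (1 + 1) + (2 + m + 0 + (2 + m)) ≡ 2 * (3 + m) + 1 ∋ solve (m ∷ []))))
      near-zxy {suc e} {x} {y} {z} e≤n d with m≤n⇒m<n∨m≡n e≤n
      ... | inj₂ refl = near-apart 2≤n
        (walk-resp (λ v → sym (blocks-wrap refl v))
                   (reverse (standard-colouring 1≤n (distinct-zxy d)) (pass (distinct-zxy d))) (λ _ → refl)
         ++ʷ walk-resp (λ v → cong (λ t → standard t z x y v) (+-comm 1 n))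
                       (reverse (standard-colouring 1≤n (distinct-zxy d)) (slide 1 (1 + m) 1+[1+[1+m]]≡n (distinct-zxy d)))
                       (λ _ → refl))
        (≤-by (2 + m) (2n+1 (2 + m + 0 + (1 + (1 + 1)) + (2 + m) ≡ 2 * (3 + m) + 1 ∋ solve (m ∷ []))))
      ... | inj₁ e<n with m≤n⇒∃[o]m+o≡n e<n
      ...   | k , 2+e+k≡n = near-apart 2≤n
        (hop-forward 1≤n d ++ʷ cycle-yzx (suc e) k 2+e+k≡n (distinct-xzy d)
         ++ʷ walk-resp (λ _ → refl) (hop-forward 1≤n (distinct-zyx d)) (blocks-wrap around))
        (≤-by e (trans (2 + (k + suc e + k + 2) + e ≡ 2 * (2 + e + k) + 1 ∋ solve (k ∷ e ∷ []))
                       (cong (λ t → 2 * t + 1) 2+e+k≡n)))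
        where
        around : n + suc (suc e) + n ≡ suc e + N n
        around = n + (2 + e) + n ≡ (1 + e) + (1 + (n + n)) ∋ solve (n ∷ e ∷ [])

      near-zyx : ∀ {e x y z} → e ≤ n → Distinct x y z → Near x z (standard 0 x y z) (standard e z y x)
      near-zyx {zero} _ d = near-apart 2≤n
        (walk-resp (λ v → sym (blocks-wrap refl v))
                   (reverse (standard-colouring 1≤n (distinct-zxy d)) (pass (distinct-zxy d))) (λ _ → refl)
         ++ʷ walk-resp (λ _ → refl) (hop-forward 1≤n (distinct-zxy d)) (blocks-wrap refl))
        (≤-by (3 + m) (2n+1 (2 + m + 0 + 2 + (3 + m) ≡ 2 * (3 + m) + 1 ∋ solve (m ∷ []))))
      near-zyx {suc e} e<n d with m≤n⇒∃[o]m+o≡n e<n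
      ... | k , 1+e+k≡n = near-apart 2≤n
        (cycle-zxy e k 1+e+k≡n d ++ʷ walk-resp (λ _ → refl) (hop-back 1≤n (distinct-zxy d)) (blocks-wrap around))
        (≤-by (1 + k) (trans (k + e + e + 2 + (1 + k) ≡ 2 * (1 + e + k) + 1 ∋ solve (k ∷ e ∷ []))
                             (cong (λ t → 2 * t + 1) 1+e+k≡n)))
        where
        around : n + suc e + suc n ≡ suc e + N n
        around = n + (1 + e) + (1 + n) ≡ (1 + e) + (1 + (n + n)) ∋ solve (n ∷ e ∷ [])

      near-standard : ∀ {e x y z d₀ d₁ d₂} → e ≤ n → Distinct x y z → Distinct d₀ d₁ d₂ →
                      Near x d₀ (standard 0 x y z) (standard e d₀ d₁ d₂)
      near-standard e≤n d d′ with arrangement d d′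
      ... | xyz = near-xyz e≤n d
      ... | xzy = near-xzy e≤n d
      ... | yxz = near-yxz e≤n d
      ... | yzx = near-yzx e≤n d
      ... | zxy = near-zxy e≤n d
      ... | zyx = near-zyx e≤n d

    shape-standard : ∀ {α} → ShapeAt n α origin →
                     α ≗ standard 0 (α origin) (α (shift n origin 1)) (α (shift n origin (n + 1)))
    shape-standard {α} (_ , _ , _ , first-block , second-block) v = begin
      α v                                          ≡⟨ cong α (shift-offset origin v) ⟨
      α (shift n origin (offset origin v))         ≡⟨ colour (offset<N origin v) ⟩
      bands 0 1 (1 + n) c₀ c₁ c₂ (offset origin v) ≡⟨ cong (λ s → bands 0 1 (1 + n) c₀ c₁ c₂ (offset s v)) (shift-zero origin) ⟨
      bands 0 1 (1 + n) c₀ c₁ c₂ (offset (shift n origin 0) v) ≡⟨ place-offset v ⟨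
      standard 0 c₀ c₁ c₂ v                        ∎
      where
      open ≡-Reasoning
      c₀ c₁ c₂ : Fin 3
      c₀ = α origin
      c₁ = α (shift n origin 1)
      c₂ = α (shift n origin (n + 1))
      colour : ∀ {t} → t < N n → α (shift n origin t) ≡ bands 0 1 (1 + n) c₀ c₁ c₂ t
      colour {zero} _ = trans (cong α (shift-zero origin)) (sym (bands-x z≤n (s≤s z≤n)))
      colour {suc t} t<N with suc t ≤? n
      ... | yes t<n = trans (first-block (suc t) (s≤s z≤n) t<n) (sym (bands-y₁ z≤n (s≤s z≤n) (s≤s t<n)))
      ... | no t≮n = trans (second-block (suc t) (subst (_≤ suc t) (+-comm 1 n) n<t) (s≤s⁻¹ t<N))
                           (sym (bands-z z≤n (s≤s z≤n) n<t))
        where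
        n<t : suc n ≤ suc t
        n<t = ≰⇒> t≮n

  -- The colourings of 𝒞 as standard colourings

  standard-rebase : ∀ a e {x y z} → Blocks.standard a e x y z ≗ Blocks.standard (shift n a e) 0 x y z
  standard-rebase a e {x} {y} {z} v =
    cong (λ s → place s (bands 0 1 (1 + n) x y z) v) (sym (shift-zero (shift n a e)))

  shape-distinct : ∀ {α a} → ShapeAt n α a → Distinct (α a) (α (shift n a 1)) (α (shift n a (n + 1)))
  shape-distinct (c₀≢c₁ , c₀≢c₂ , c₁≢c₂ , _) = c₀≢c₁ , c₁≢c₂ , c₀≢c₂

  offsets-split : ∀ a b → offset a b ≤ n ⊎ offset b a ≤ n
  offsets-split a b with offset a b ≤? n | offset b a ≤? n
  ... | yes e≤n | _ = inj₁ e≤n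
  ... | no _ | yes e′≤n = inj₂ e′≤n
  ... | no e≰n | no e′≰n = contradiction (+-%-cases {d = N n} (offset<N a b) (<⇒≤ (offset<N b a))) impossible
    where
    e e′ : ℕ
    e = offset a b
    e′ = offset b a
    round-trip : (e + e′) % N n ≡ 0
    round-trip = begin
      (e + e′) % N n                 ≡⟨ offset-shift a (e + e′) ⟨
      offset a (shift n a (e + e′))  ≡⟨ cong (offset a) (shift-+ a e e′) ⟨
      offset a (shift n (shift n a e) e′) ≡⟨ cong (λ s → offset a (shift n s e′)) (shift-offset a b) ⟩
      offset a (shift n b e′)        ≡⟨ cong (offset a) (shift-offset b a) ⟩
      offset a a                     ≡⟨ cong (offset a) (shift-zero a) ⟨
      offset a (shift n a 0)         ≡⟨ offset-shift a 0 ⟩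
      0                              ∎
      where open ≡-Reasoning
    N<e+e′ : N n < e + e′
    N<e+e′ = ≤-trans (s≤s (≤-reflexive (sym (+-suc n n)))) (+-mono-≤ (≰⇒> e≰n) (≰⇒> e′≰n))
    impossible : ¬ (e + e′ ≡ (e + e′) % N n ⊎ e + e′ ≡ (e + e′) % N n + N n)
    impossible (inj₁ eq) = contradiction (trans eq round-trip) λ e+e′≡0 → <⇒≢ (≤-<-trans z≤n N<e+e′) (sym e+e′≡0)
    impossible (inj₂ eq) = <-irrefl (sym (trans eq (cong (_+ N n) round-trip))) N<e+e′

  shape-as-standard : ∀ {β b} → ShapeAt n β b → ∀ a →
    Blocks.standard a (offset a b) (β b) (β (shift n b 1)) (β (shift n b (n + 1))) ≗ β
  shape-as-standard {β} {b} β-shape a v = begin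
    Blocks.standard a (offset a b) c₀ c₁ c₂ v          ≡⟨ standard-rebase a (offset a b) v ⟩
    Blocks.standard (shift n a (offset a b)) 0 c₀ c₁ c₂ v ≡⟨ cong (λ s → Blocks.standard s 0 c₀ c₁ c₂ v) (shift-offset a b) ⟩
    Blocks.standard b 0 c₀ c₁ c₂ v                    ≡⟨ Blocks.shape-standard b {β} β-shape v ⟨
    β v                                               ∎
    where
    open ≡-Reasoning
    c₀ c₁ c₂ : Fin 3
    c₀ = β b
    c₁ = β (shift n b 1)
    c₂ = β (shift n b (n + 1))

  near : 3 ≤ n → ∀ {α β a b} → ShapeAt n α a → ShapeAt n β b → Near (α a) (β b) α β
  near 3≤n {α} {β} {a} {b} α-shape β-shape with m≤n⇒∃[o]m+o≡n 3≤n | offsets-split a b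
  ... | m , 3+m≡n | inj₁ e≤n =
    near-resp (Blocks.shape-standard a {α} α-shape) (shape-as-standard {β} β-shape a)
              (Blocks.near-standard a m (sym 3+m≡n) e≤n (shape-distinct {α} α-shape) (shape-distinct {β} β-shape))
  ... | m , 3+m≡n | inj₂ e≤n =
    near-sym (colouring-resp (Blocks.shape-standard b {β} β-shape)
                             (Blocks.standard-colouring b (≤-trans (s≤s z≤n) 3≤n) (shape-distinct {β} β-shape)))
             (near-resp (Blocks.shape-standard b {β} β-shape) (shape-as-standard {α} α-shape b)
                        (Blocks.near-standard b m (sym 3+m≡n) e≤n (shape-distinct {β} β-shape) (shape-distinct {α} α-shape)))

lemma6 : (n : ℕ) → 3 ≤ n → (α β : Col n) → InC n α → InC n β →
           DistLe n α β (3 * n ∸ 1)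
           × ((a b : V n) → ShapeAt n α a → ShapeAt n β b → α a ≢ β b →
                DistLe n α β (2 * n + 1))
lemma6 n 3≤n α β (_ , a , α-shape) (_ , b , β-shape) =
  proj₁ (near n 3≤n {α} {β} α-shape β-shape) ,
  λ _ _ α-shape′ β-shape′ → proj₂ (near n 3≤n {α} {β} α-shape′ β-shape′)
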